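{- Let $\mathcal{C}$ be a set of subsets of $E$ each containing at most one skew pair. Then $\mathcal{C}$ is the set of circuits of an antisymmetric matroid on $E$ if and only if: (C1) $\emptyset\notin\mathcal{C}$; (C2) if $C_1,C_2\in\mathcal{C}$ and $C_1\subseteq C_2$ then $C_1=C_2$; (Orth) $|C_1\cap C_2^*|\ne1$ for all $C_1,C_2\in\mathcal{C}$; (Max) for every transversal $T$ and every $e\in T^*$ there is $C\in\mathcal{C}$ with $C\subseteq T\cup\{e\}$.
   Context: Let $E=[n]\cup[n]^*$ with involution $i\leftrightarrow i^*$ (extended to sets by $X^*=\{x^*:x\in X\}$, with $(i^*)^*=i$). A skew pair is $\{i,i^*\}$; $\mathcal{T}_n$ is the set of transversals ($n$-subsets of $E$ with no skew pair) and $\mathcal{A}_n$ the set of almost-transversals ($n$-subsets with exactly one skew pair). An antisymmetric matroid on $E$ is $(E,\mathcal{B})$ with $\mathcal{B}\subseteq\mathcal{T}_n\cup\mathcal{A}_n$ satisfying (B1) $\mathcal{B}\ne\emptyset$; (B2) for $T\in\mathcal{T}_n$ and distinct skew pairs $p,q$, $(T\cup p)\setminus q\in\mathcal{B}$ iff $(T\cup q)\setminus p\in\mathcal{B}$; (Exch) for $B,B'\in\mathcal{B}$ and $e\in B\setminus B'$ with $B\setminus\{e\}$ having no skew pair and $B'\cup\{e\}$ having exactly one skew pair, there is $f\in B'\setminus B$ with both $(B\setminus\{e\})\cup\{f\}$ and $(B'\cup\{e\})\setminus\{f\}$ in $\mathcal{B}$. A circuit of such a matroid is an inclusion-minimal subset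 $C\subseteq E$ containing at most one skew pair that is not contained in any basis. -}

module Defs where

open import Data.Bool using (Bool; true; false)
open import Data.Nat using (ℕ; _+_; _≤_)
open import Data.Fin using (Fin)
open import Data.Fin.Subset as S using (Subset; ⁅_⁆; ⊥)
open import Data.Product using (_×_; _,_; proj₁; proj₂; ∃; ∃-syntax)
open import Data.Sum using (_⊎_)
open import Relation.Binary.PropositionalEquality using (_≡_; _≢_)
open import Relation.Nullary using (¬_)

-- Ground set E = [n] ∪ [n]*.  An element is (i , s) with s = false for i
-- and s = true for i*.
Elt : ℕ → Set
Elt n = Fin n × Bool

-- A subset X ⊆ E is a pair (unstarred part , starred part):
-- i ∈ X iff i ∈ proj₁ X, and i* ∈ X iff i ∈ proj₂ X.
SubE : ℕ → Set
SubE n = Subset n × Subset n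

Family : ℕ → Set
Family n = SubE n → Bool

_∈F_ : {n : ℕ} → SubE n → Family n → Set
X ∈F 𝓕 = 𝓕 X ≡ true

infix 4 _∈E_ _⊆E_ _∈F_
infixr 7 _∩E_
infixr 6 _∪E_
infixl 5 _∖E_

_∈E_ : {n : ℕ} → Elt n → SubE n → Set
(i , false) ∈E X = i S.∈ proj₁ X
(i , true)  ∈E X = i S.∈ proj₂ X

_⊆E_ : {n : ℕ} → SubE n → SubE n → Set
X ⊆E Y = (proj₁ X S.⊆ proj₁ Y) × (proj₂ X S.⊆ proj₂ Y)

_∪E_ : {n : ℕ} → SubE n → SubE n → SubE n
X ∪E Y = (proj₁ X S.∪ proj₁ Y , proj₂ X S.∪ proj₂ Y)

_∩E_ : {n : ℕ} → SubE n → SubE n → SubE n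
X ∩E Y = (proj₁ X S.∩ proj₁ Y , proj₂ X S.∩ proj₂ Y)

_∖E_ : {n : ℕ} → SubE n → SubE n → SubE n
X ∖E Y = (proj₁ X S.─ proj₁ Y , proj₂ X S.─ proj₂ Y)

star : {n : ℕ} → SubE n → SubE n
star X = (proj₂ X , proj₁ X)

sing : {n : ℕ} → Elt n → SubE n
sing (i , false) = (⁅ i ⁆ , ⊥)
sing (i , true)  = (⊥ , ⁅ i ⁆)

skew : {n : ℕ} → Fin n → SubE n
skew i = (⁅ i ⁆ , ⁅ i ⁆)

card : {n : ℕ} → SubE n → ℕ
card X = S.∣ proj₁ X ∣ + S.∣ proj₂ X ∣

skewCount : {n : ℕ} → SubE n → ℕ
skewCount X = S.∣ proj₁ X S.∩ proj₂ X ∣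

Transversal : {n : ℕ} → SubE n → Set
Transversal {n} X = card X ≡ n × skewCount X ≡ 0

AlmostTransversal : {n : ℕ} → SubE n → Set
AlmostTransversal {n} X = card X ≡ n × skewCount X ≡ 1

record IsAntisymmetricMatroid {n : ℕ} (𝓑 : Family n) : Set where
  field
    bases-shape : ∀ B → B ∈F 𝓑 → Transversal B ⊎ AlmostTransversal B
    B1 : ∃[ B ] (B ∈F 𝓑)
    B2 : ∀ T → Transversal T → (p q : Fin n) → p ≢ q →
         (((T ∪E skew p) ∖E skew q) ∈F 𝓑 → ((T ∪E skew q) ∖E skew p) ∈F 𝓑)
       × (((T ∪E skew q) ∖E skew p) ∈F 𝓑 → ((T ∪E skew p) ∖E skew q) ∈F 𝓑)
    Exch : ∀ B B' → B ∈F 𝓑 → B' ∈F 𝓑 → (e : Elt n) →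
           e ∈E B → ¬ (e ∈E B') →
           skewCount (B ∖E sing e) ≡ 0 → skewCount (B' ∪E sing e) ≡ 1 →
           ∃[ f ] (f ∈E B' × ¬ (f ∈E B)
                  × ((B ∖E sing e) ∪E sing f) ∈F 𝓑
                  × ((B' ∪E sing e) ∖E sing f) ∈F 𝓑)

NotInAnyBasis : {n : ℕ} → Family n → SubE n → Set
NotInAnyBasis 𝓑 C = ∀ B → B ∈F 𝓑 → ¬ (C ⊆E B)

IsCircuit : {n : ℕ} → Family n → SubE n → Set
IsCircuit 𝓑 C =
    skewCount C ≤ 1
  × NotInAnyBasis 𝓑 C
  × (∀ D → D ⊆E C → D ≢ C → skewCount D ≤ 1 → ¬ NotInAnyBasis 𝓑 D)

IsCircuitSetOfAntisymmetricMatroid : {n : ℕ} → Family n → Set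
IsCircuitSetOfAntisymmetricMatroid {n} 𝓒 =
  ∃[ 𝓑 ] (IsAntisymmetricMatroid 𝓑
         × (∀ C → (C ∈F 𝓒 → IsCircuit 𝓑 C) × (IsCircuit 𝓑 C → C ∈F 𝓒)))

C1 : {n : ℕ} → Family n → Set
C1 𝓒 = ¬ ((⊥ , ⊥) ∈F 𝓒)

C2 : {n : ℕ} → Family n → Set
C2 𝓒 = ∀ C₁ C₂ → C₁ ∈F 𝓒 → C₂ ∈F 𝓒 → C₁ ⊆E C₂ → C₁ ≡ C₂

Orth : {n : ℕ} → Family n → Set
Orth 𝓒 = ∀ C₁ C₂ → C₁ ∈F 𝓒 → C₂ ∈F 𝓒 → card (C₁ ∩E star C₂) ≢ 1

Max : {n : ℕ} → Family n → Set
Max 𝓒 = ∀ T → Transversal T → (e : Elt _) → e ∈E star T →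
        ∃[ C ] (C ∈F 𝓒 × C ⊆E (T ∪E sing e))

{-# OPTIONS --safe #-}
-- Write ∁* X = E ∖ X*.  Bases of an antisymmetric matroid have n elements and at most one skew
-- pair, and ∁* maps bases to bases: it fixes transversals and sends an almost-transversal to its
-- B2-partner.
--
-- Circuits ⇒ axioms.  C1, C2 and Max are immediate.  For Orth, suppose C₁ ∩ C₂* = {e}.  For a
-- circuit C and e ∈ C there is a basis B ⊇ C − e such that B + e has exactly one skew pair.  With
-- such B for (C₁, e) and B₂ for (C₂, e*), exchange e between ∁* B₂ and B: if the returned f lies in
-- C₁ then C₂ ⊆ ∁* (∁* B₂ − e + f), otherwise C₁ ⊆ B + e − f; either way a circuit lies in a basis.
--
-- Axioms ⇒ circuits.  Take as bases the n-sets with at most one skew pair containing no member of 𝒞.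
-- By Max, every (n + 1)-set with one skew pair contains a member of 𝒞.  Orth then shows that
-- independent sets extend to bases (J + q and J + q* cannot both be dependent), that ∁* preserves
-- bases (which gives B2), and, for Exch, that the member C ⊆ B′ + e and the member D ⊆ ∁* B + e*
-- of 𝒞 have, besides e, some f ∈ C with f* ∈ D; this f is the one to exchange.

module Submission where

open import Defs
open import Data.Bool using (Bool; true; false; not; _∧_; _∨_)
import Data.Bool.Properties as Boolₚ
open import Data.Empty using (⊥; ⊥-elim)
open import Data.Fin using (Fin; zero; suc)
import Data.Fin.Properties as Finₚ
open import Data.Fin.Subset as S using (Subset; ⁅_⁆; ∁)
import Data.Fin.Subset.Properties as Sₚ
open import Data.Nat using (ℕ; zero; suc; _+_; _≤_; _<_; z≤n; _≟_; _≤?_)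
open import Data.Nat.Properties
open import Data.Product using (_×_; _,_; proj₁; proj₂; ∃; ∃-syntax)
import Data.Product.Properties as ×ₚ
open import Data.Sum using (_⊎_; inj₁; inj₂)
open import Data.Vec using (_∷_; []; lookup; here)
import Data.Vec.Properties as Vecₚ
open import Function using (_∘_; id; case_of_)
open import Function.Bundles using (_⇔_; mk⇔; Equivalence)
open import Relation.Binary.Definitions using (DecidableEquality)
open import Relation.Binary.PropositionalEquality
open import Relation.Nullary using (¬_; Dec; yes; no; contradiction)
open import Relation.Nullary.Decidable
  using (_×-dec_; _⊎-dec_; ¬?; map′; decidable-stable; ⌊_⌋; toWitness; fromWitness)

private
  variable
    n : ℕ

infix 10 _*

_* : Elt n → Elt n
(i , b) * = (i , not b)

*-involutive : (x : Elt n) → x * * ≡ x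
*-involutive (i , b) = cong (i ,_) (Boolₚ.not-involutive b)

*-injective : {x y : Elt n} → x * ≡ y * → x ≡ y
*-injective {x = x} {y} eq = trans (sym (*-involutive x)) (trans (cong _* eq) (*-involutive y))

*-≢ : (x : Elt n) → x * ≢ x
*-≢ (i , b) eq = Boolₚ.not-¬ refl (sym (cong proj₂ eq))

infix 4 _≟ᵉ_

_≟ᵉ_ : DecidableEquality (Elt n)
_≟ᵉ_ = ×ₚ.≡-dec Finₚ._≟_ Boolₚ._≟_

infix 4.5 _∈ᵇ_
infix 4 _∈_ _∉_ _⊆_ _∈?_
infixl 6 _∪⁅_⁆ _∖⁅_⁆

_∈ᵇ_ : Elt n → SubE n → Bool
(i , false) ∈ᵇ X = lookup (proj₁ X) i
(i , true)  ∈ᵇ X = lookup (proj₂ X) i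

-- A record rather than `x ∈ᵇ X ≡ true`, so that x and X can be inferred from membership proofs.
record _∈_ (x : Elt n) (X : SubE n) : Set where
  constructor ∈ᵇ⇒∈
  field ∈⇒∈ᵇ : x ∈ᵇ X ≡ true
open _∈_ public

_∉_ : Elt n → SubE n → Set
x ∉ X = ¬ x ∈ X

∉⇒∈ᵇ : {x : Elt n} {X : SubE n} → x ∉ X → x ∈ᵇ X ≡ false
∉⇒∈ᵇ x∉ = Boolₚ.¬-not (x∉ ∘ ∈ᵇ⇒∈)

∈ᵇ⇒∉ : {x : Elt n} {X : SubE n} → x ∈ᵇ X ≡ false → x ∉ X
∈ᵇ⇒∉ eq (∈ᵇ⇒∈ eq′) = Boolₚ.not-¬ eq eq′

_∈?_ : (x : Elt n) (X : SubE n) → Dec (x ∈ X)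
x ∈? X with x ∈ᵇ X in eq
... | true  = yes (∈ᵇ⇒∈ eq)
... | false = no (∈ᵇ⇒∉ eq)

_⊆_ : SubE n → SubE n → Set
X ⊆ Y = ∀ {x} → x ∈ X → x ∈ Y

-- Opaque, so that unification treats them as rigid.
opaque
  _∪⁅_⁆ _∖⁅_⁆ : SubE n → Elt n → SubE n
  X ∪⁅ x ⁆ = X ∪E sing x
  X ∖⁅ x ⁆ = X ∖E sing x

  ∁* : SubE n → SubE n
  ∁* X = (∁ (proj₂ X) , ∁ (proj₁ X))

∅ : SubE n
∅ = (S.⊥ , S.⊥)

∈E⇒∈ : (x : Elt n) {X : SubE n} → x ∈E X → x ∈ X
∈E⇒∈ (i , false) = ∈ᵇ⇒∈ ∘ Vecₚ.[]=⇒lookup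
∈E⇒∈ (i , true)  = ∈ᵇ⇒∈ ∘ Vecₚ.[]=⇒lookup

∈⇒∈E : (x : Elt n) {X : SubE n} → x ∈ X → x ∈E X
∈⇒∈E (i , false) = Vecₚ.lookup⇒[]= i _ ∘ ∈⇒∈ᵇ
∈⇒∈E (i , true)  = Vecₚ.lookup⇒[]= i _ ∘ ∈⇒∈ᵇ

⊆E⇒⊆ : {X Y : SubE n} → X ⊆E Y → X ⊆ Y
⊆E⇒⊆ (sub₁ , sub₂) {x} = ∈E⇒∈ x ∘ componentwise x ∘ ∈⇒∈E x
  where
  componentwise : ∀ x → x ∈E _ → x ∈E _
  componentwise (i , false) = sub₁
  componentwise (i , true)  = sub₂

⊆⇒⊆E : {X Y : SubE n} → X ⊆ Y → X ⊆E Y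
⊆⇒⊆E sub = (λ {i} → ∈⇒∈E (i , false) ∘ sub ∘ ∈E⇒∈ (i , false))
          , (λ {i} → ∈⇒∈E (i , true) ∘ sub ∘ ∈E⇒∈ (i , true))

ext : {X Y : SubE n} → (∀ x → x ∈ᵇ X ≡ x ∈ᵇ Y) → X ≡ Y
ext h = cong₂ _,_ (lookup-ext (λ i → h (i , false))) (lookup-ext (λ i → h (i , true)))
  where
  lookup-ext : {p q : Subset n} → (∀ i → lookup p i ≡ lookup q i) → p ≡ q
  lookup-ext {p = p} {q} h =
    trans (sym (Vecₚ.tabulate∘lookup p)) (trans (Vecₚ.tabulate-cong h) (Vecₚ.tabulate∘lookup q))

⊆-antisym : {X Y : SubE n} → X ⊆ Y → Y ⊆ X → X ≡ Y
⊆-antisym X⊆Y Y⊆X = ext λ x → Boolₚ.⇔→≡ (mk⇔ (∈⇒∈ᵇ ∘ X⊆Y {x} ∘ ∈ᵇ⇒∈) (∈⇒∈ᵇ ∘ Y⊆X {x} ∘ ∈ᵇ⇒∈))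

lookup-─ : (p q : Subset n) (i : Fin n) → lookup (p S.─ q) i ≡ lookup p i ∧ not (lookup q i)
lookup-─ (b ∷ p) (true  ∷ q) zero    = sym (Boolₚ.∧-zeroʳ b)
lookup-─ (b ∷ p) (false ∷ q) zero    = sym (Boolₚ.∧-identityʳ b)
lookup-─ (_ ∷ p) (_ ∷ q)     (suc i) = lookup-─ p q i

∈ᵇ-∪ : (x : Elt n) (X Y : SubE n) → x ∈ᵇ X ∪E Y ≡ (x ∈ᵇ X) ∨ (x ∈ᵇ Y)
∈ᵇ-∪ (i , false) X Y = Vecₚ.lookup-zipWith _∨_ i (proj₁ X) (proj₁ Y)
∈ᵇ-∪ (i , true)  X Y = Vecₚ.lookup-zipWith _∨_ i (proj₂ X) (proj₂ Y)

∈ᵇ-∩ : (x : Elt n) (X Y : SubE n) → x ∈ᵇ X ∩E Y ≡ (x ∈ᵇ X) ∧ (x ∈ᵇ Y)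
∈ᵇ-∩ (i , false) X Y = Vecₚ.lookup-zipWith _∧_ i (proj₁ X) (proj₁ Y)
∈ᵇ-∩ (i , true)  X Y = Vecₚ.lookup-zipWith _∧_ i (proj₂ X) (proj₂ Y)

∈ᵇ-∖ : (x : Elt n) (X Y : SubE n) → x ∈ᵇ X ∖E Y ≡ (x ∈ᵇ X) ∧ not (x ∈ᵇ Y)
∈ᵇ-∖ (i , false) X Y = lookup-─ (proj₁ X) (proj₁ Y) i
∈ᵇ-∖ (i , true)  X Y = lookup-─ (proj₂ X) (proj₂ Y) i

∈ᵇ-star : (x : Elt n) (X : SubE n) → x ∈ᵇ star X ≡ x * ∈ᵇ X
∈ᵇ-star (i , false) X = refl
∈ᵇ-star (i , true)  X = refl

∁-∪ : (p q : Subset n) → ∁ (p S.∪ q) ≡ ∁ p S.─ q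
∁-∪ []      []          = refl
∁-∪ (b ∷ p) (true  ∷ q) = cong₂ _∷_ (cong not (Boolₚ.∨-zeroʳ b)) (∁-∪ p q)
∁-∪ (b ∷ p) (false ∷ q) = cong₂ _∷_ (cong not (Boolₚ.∨-identityʳ b)) (∁-∪ p q)

∁-─ : (p q : Subset n) → ∁ (p S.─ q) ≡ ∁ p S.∪ q
∁-─ []      []          = refl
∁-─ (b ∷ p) (true  ∷ q) = cong₂ _∷_ (sym (Boolₚ.∨-zeroʳ (not b))) (∁-─ p q)
∁-─ (b ∷ p) (false ∷ q) = cong₂ _∷_ (sym (Boolₚ.∨-identityʳ (not b))) (∁-─ p q)

∁-involutive : (p : Subset n) → ∁ (∁ p) ≡ p
∁-involutive []      = refl
∁-involutive (b ∷ p) = cong₂ _∷_ (Boolₚ.not-involutive b) (∁-involutive p)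

opaque
  unfolding ∁*

  ∈ᵇ-∁* : (x : Elt n) (X : SubE n) → x ∈ᵇ ∁* X ≡ not (x * ∈ᵇ X)
  ∈ᵇ-∁* (i , false) X = Vecₚ.lookup-map i not (proj₂ X)
  ∈ᵇ-∁* (i , true)  X = Vecₚ.lookup-map i not (proj₁ X)

  ∁*-involutive : (X : SubE n) → ∁* (∁* X) ≡ X
  ∁*-involutive (p , q) = cong₂ _,_ (∁-involutive p) (∁-involutive q)

∈-∩⁻ : {x : Elt n} (X Y : SubE n) → x ∈ X ∩E Y → x ∈ X × x ∈ Y
∈-∩⁻ {x = x} X Y (∈ᵇ⇒∈ eq) with x ∈ᵇ X in eqX | x ∈ᵇ Y in eqY | trans (sym (∈ᵇ-∩ x X Y)) eq
... | true | true | _ = ∈ᵇ⇒∈ eqX , ∈ᵇ⇒∈ eqY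

∈-∩⁺ : {x : Elt n} {X Y : SubE n} → x ∈ X → x ∈ Y → x ∈ X ∩E Y
∈-∩⁺ {x = x} {X} {Y} (∈ᵇ⇒∈ p) (∈ᵇ⇒∈ q) = ∈ᵇ⇒∈ (trans (∈ᵇ-∩ x X Y) (cong₂ _∧_ p q))

∈-star⁻ : {x : Elt n} (X : SubE n) → x ∈ star X → x * ∈ X
∈-star⁻ {x = x} X (∈ᵇ⇒∈ eq) = ∈ᵇ⇒∈ (trans (sym (∈ᵇ-star x X)) eq)

∈-star⁺ : {x : Elt n} {X : SubE n} → x * ∈ X → x ∈ star X
∈-star⁺ {x = x} {X} (∈ᵇ⇒∈ eq) = ∈ᵇ⇒∈ (trans (∈ᵇ-star x X) eq)

∈-∁*⁺ : {x : Elt n} {X : SubE n} → x * ∉ X → x ∈ ∁* X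
∈-∁*⁺ {x = x} {X} x*∉ = ∈ᵇ⇒∈ (trans (∈ᵇ-∁* x X) (cong not (∉⇒∈ᵇ x*∉)))

∈-∁*⁻ : {x : Elt n} (X : SubE n) → x ∈ ∁* X → x * ∉ X
∈-∁*⁻ {x = x} X (∈ᵇ⇒∈ eq) (∈ᵇ⇒∈ eq′) =
  Boolₚ.not-¬ (trans (sym (∈ᵇ-∁* x X)) eq) (cong not eq′)

∈⇒*∉∁* : {X : SubE n} {x : Elt n} → x ∈ X → x * ∉ ∁* X
∈⇒*∉∁* {X = X} {x} x∈ x*∈ = ∈-∁*⁻ X x*∈ (subst (_∈ X) (sym (*-involutive x)) x∈)

lookup-⁅x⁆ : (i : Fin n) → lookup ⁅ i ⁆ i ≡ true
lookup-⁅x⁆ i = Vecₚ.[]=⇒lookup (Sₚ.x∈⁅x⁆ i)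

lookup-⁅y⁆ : {i j : Fin n} → j ≢ i → lookup ⁅ i ⁆ j ≡ false
lookup-⁅y⁆ {i = i} {j} j≢i = Boolₚ.¬-not (j≢i ∘ Sₚ.x∈⁅y⁆⇒x≡y i ∘ Vecₚ.lookup⇒[]= j _)

∈ᵇ-sing-self : (x : Elt n) → x ∈ᵇ sing x ≡ true
∈ᵇ-sing-self (i , false) = lookup-⁅x⁆ i
∈ᵇ-sing-self (i , true)  = lookup-⁅x⁆ i

∈ᵇ-sing-≢ : {x y : Elt n} → y ≢ x → y ∈ᵇ sing x ≡ false
∈ᵇ-sing-≢ {x = i , false} {j , false} y≢x = lookup-⁅y⁆ (y≢x ∘ cong (_, false))
∈ᵇ-sing-≢ {x = i , false} {j , true}  y≢x = Vecₚ.lookup-replicate j false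
∈ᵇ-sing-≢ {x = i , true}  {j , false} y≢x = Vecₚ.lookup-replicate j false
∈ᵇ-sing-≢ {x = i , true}  {j , true}  y≢x = lookup-⁅y⁆ (y≢x ∘ cong (_, true))

∈-sing⇒≡ : {x y : Elt n} → y ∈ sing x → y ≡ x
∈-sing⇒≡ {x = x} {y} (∈ᵇ⇒∈ eq) with y ≟ᵉ x
... | yes y≡x = y≡x
... | no  y≢x = contradiction eq (Boolₚ.not-¬ (∈ᵇ-sing-≢ y≢x))

∈ᵇ-skew-self : (i : Fin n) (b : Bool) → (i , b) ∈ᵇ skew i ≡ true
∈ᵇ-skew-self i false = lookup-⁅x⁆ i
∈ᵇ-skew-self i true  = lookup-⁅x⁆ i

∈ᵇ-skew-≢ : {i j : Fin n} (b : Bool) → j ≢ i → (j , b) ∈ᵇ skew i ≡ false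
∈ᵇ-skew-≢ false = lookup-⁅y⁆
∈ᵇ-skew-≢ true  = lookup-⁅y⁆

∉∅ : {x : Elt n} → x ∉ ∅
∉∅ {x = i , false} (∈ᵇ⇒∈ eq) = Boolₚ.not-¬ (Vecₚ.lookup-replicate i false) eq
∉∅ {x = i , true}  (∈ᵇ⇒∈ eq) = Boolₚ.not-¬ (Vecₚ.lookup-replicate i false) eq

opaque
  unfolding _∪⁅_⁆ _∖⁅_⁆

  ∈ᵇ-∪⁅⁆-≢ : (y : Elt n) (X : SubE n) (x : Elt n) → y ≢ x → y ∈ᵇ X ∪⁅ x ⁆ ≡ y ∈ᵇ X
  ∈ᵇ-∪⁅⁆-≢ y X x y≢x =
    trans (∈ᵇ-∪ y X (sing x)) (trans (cong ((y ∈ᵇ X) ∨_) (∈ᵇ-sing-≢ y≢x)) (Boolₚ.∨-identityʳ _))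

  ∈ᵇ-∖⁅⁆-≢ : (y : Elt n) (X : SubE n) (x : Elt n) → y ≢ x → y ∈ᵇ X ∖⁅ x ⁆ ≡ y ∈ᵇ X
  ∈ᵇ-∖⁅⁆-≢ y X x y≢x =
    trans (∈ᵇ-∖ y X (sing x)) (trans (cong (λ b → (y ∈ᵇ X) ∧ not b) (∈ᵇ-sing-≢ y≢x)) (Boolₚ.∧-identityʳ _))

  ∈ᵇ-∪⁅⁆-self : (X : SubE n) (x : Elt n) → x ∈ᵇ X ∪⁅ x ⁆ ≡ true
  ∈ᵇ-∪⁅⁆-self X x =
    trans (∈ᵇ-∪ x X (sing x)) (trans (cong ((x ∈ᵇ X) ∨_) (∈ᵇ-sing-self x)) (Boolₚ.∨-zeroʳ _))

  ∈ᵇ-∖⁅⁆-self : (X : SubE n) (x : Elt n) → x ∈ᵇ X ∖⁅ x ⁆ ≡ false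
  ∈ᵇ-∖⁅⁆-self X x =
    trans (∈ᵇ-∖ x X (sing x)) (trans (cong (λ b → (x ∈ᵇ X) ∧ not b) (∈ᵇ-sing-self x)) (Boolₚ.∧-zeroʳ _))

  ⊆-∪⁅⁆ : {X : SubE n} {x : Elt n} → X ⊆ X ∪⁅ x ⁆
  ⊆-∪⁅⁆ {X = X} {x} {y} (∈ᵇ⇒∈ eq) = ∈ᵇ⇒∈ (trans (∈ᵇ-∪ y X (sing x)) (cong (_∨ (y ∈ᵇ sing x)) eq))

∈-∪⁅⁆-self : {X : SubE n} {x : Elt n} → x ∈ X ∪⁅ x ⁆
∈-∪⁅⁆-self {X = X} {x} = ∈ᵇ⇒∈ (∈ᵇ-∪⁅⁆-self X x)

∉-∖⁅⁆-self : {X : SubE n} {x : Elt n} → x ∉ X ∖⁅ x ⁆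
∉-∖⁅⁆-self {X = X} {x} = ∈ᵇ⇒∉ (∈ᵇ-∖⁅⁆-self X x)

∈-∪⁅⁆⁻ : {X : SubE n} {x y : Elt n} → y ∈ X ∪⁅ x ⁆ → y ≡ x ⊎ y ∈ X
∈-∪⁅⁆⁻ {X = X} {x} {y} (∈ᵇ⇒∈ eq) with y ≟ᵉ x
... | yes y≡x = inj₁ y≡x
... | no  y≢x = inj₂ (∈ᵇ⇒∈ (trans (sym (∈ᵇ-∪⁅⁆-≢ y X x y≢x)) eq))

∈-∪⁅⁆-≢ : {X : SubE n} {x y : Elt n} → y ∈ X ∪⁅ x ⁆ → y ≢ x → y ∈ X
∈-∪⁅⁆-≢ y∈ y≢x with ∈-∪⁅⁆⁻ y∈
... | inj₁ y≡x = contradiction y≡x y≢x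
... | inj₂ y∈X = y∈X

∖⁅⁆-⊆ : {X : SubE n} {x : Elt n} → X ∖⁅ x ⁆ ⊆ X
∖⁅⁆-⊆ {X = X} {x} {y} (∈ᵇ⇒∈ eq) with y ≟ᵉ x
... | yes refl = contradiction eq (Boolₚ.not-¬ (∈ᵇ-∖⁅⁆-self X y))
... | no  y≢x = ∈ᵇ⇒∈ (trans (sym (∈ᵇ-∖⁅⁆-≢ y X x y≢x)) eq)

∈-∖⁅⁆⇒≢ : {X : SubE n} {x y : Elt n} → y ∈ X ∖⁅ x ⁆ → y ≢ x
∈-∖⁅⁆⇒≢ y∈ refl = ∉-∖⁅⁆-self y∈

∈-∖⁅⁆⁺ : {X : SubE n} {x y : Elt n} → y ≢ x → y ∈ X → y ∈ X ∖⁅ x ⁆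
∈-∖⁅⁆⁺ {X = X} {x} {y} y≢x (∈ᵇ⇒∈ eq) = ∈ᵇ⇒∈ (trans (∈ᵇ-∖⁅⁆-≢ y X x y≢x) eq)

⊆-∖⁅⁆ : {X Y : SubE n} {x : Elt n} → X ⊆ Y → x ∉ X → X ⊆ Y ∖⁅ x ⁆
⊆-∖⁅⁆ X⊆Y x∉X y∈X = ∈-∖⁅⁆⁺ (λ { refl → x∉X y∈X }) (X⊆Y y∈X)

∖⁅⁆⊆⇒⊆∪⁅⁆ : {X Y : SubE n} {x : Elt n} → X ∖⁅ x ⁆ ⊆ Y → X ⊆ Y ∪⁅ x ⁆
∖⁅⁆⊆⇒⊆∪⁅⁆ {x = x} X∖x⊆Y {y} y∈X with y ≟ᵉ x
... | yes refl = ∈-∪⁅⁆-self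
... | no  y≢x = ⊆-∪⁅⁆ (X∖x⊆Y (∈-∖⁅⁆⁺ y≢x y∈X))

∖⁅⁆⊆⇒⊆ : {X Y : SubE n} {x : Elt n} → X ∖⁅ x ⁆ ⊆ Y → x ∈ Y → X ⊆ Y
∖⁅⁆⊆⇒⊆ {x = x} X∖x⊆Y x∈Y {y} y∈X with y ≟ᵉ x
... | yes refl = x∈Y
... | no  y≢x = X∖x⊆Y (∈-∖⁅⁆⁺ y≢x y∈X)

⊆∪⁅⁆⇒⊆ : {X Y : SubE n} {x : Elt n} → X ⊆ Y ∪⁅ x ⁆ → x ∉ X → X ⊆ Y
⊆∪⁅⁆⇒⊆ X⊆ x∉X y∈X with ∈-∪⁅⁆⁻ (X⊆ y∈X)
... | inj₁ refl = contradiction y∈X x∉X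
... | inj₂ y∈Y  = y∈Y

∪⁅⁆-mono : {X Y : SubE n} {x : Elt n} → X ⊆ Y → X ∪⁅ x ⁆ ⊆ Y ∪⁅ x ⁆
∪⁅⁆-mono X⊆Y y∈ with ∈-∪⁅⁆⁻ y∈
... | inj₁ refl = ∈-∪⁅⁆-self
... | inj₂ y∈X  = ⊆-∪⁅⁆ (X⊆Y y∈X)

∖⁅⁆-mono : {X Y : SubE n} {x : Elt n} → X ⊆ Y → X ∖⁅ x ⁆ ⊆ Y ∖⁅ x ⁆
∖⁅⁆-mono X⊆Y y∈ = ∈-∖⁅⁆⁺ (∈-∖⁅⁆⇒≢ y∈) (X⊆Y (∖⁅⁆-⊆ y∈))

∖⁅⁆-∪⁅⁆ : {X : SubE n} {x : Elt n} → x ∈ X → X ∖⁅ x ⁆ ∪⁅ x ⁆ ≡ X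
∖⁅⁆-∪⁅⁆ {X = X} {x} x∈ = ⊆-antisym ⊆X (∖⁅⁆⊆⇒⊆∪⁅⁆ id)
  where
  ⊆X : X ∖⁅ x ⁆ ∪⁅ x ⁆ ⊆ X
  ⊆X y∈ with ∈-∪⁅⁆⁻ y∈
  ... | inj₁ refl = x∈
  ... | inj₂ y∈′ = ∖⁅⁆-⊆ y∈′

opaque
  unfolding ∁* _∪⁅_⁆ _∖⁅_⁆

  ∁*-∪⁅⁆ : (X : SubE n) (x : Elt n) → ∁* (X ∪⁅ x ⁆) ≡ ∁* X ∖⁅ x * ⁆
  ∁*-∪⁅⁆ X (i , false) = cong₂ _,_ (∁-∪ _ _) (∁-∪ _ _)
  ∁*-∪⁅⁆ X (i , true)  = cong₂ _,_ (∁-∪ _ _) (∁-∪ _ _)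

  ∁*-∖⁅⁆ : (X : SubE n) (x : Elt n) → ∁* (X ∖⁅ x ⁆) ≡ ∁* X ∪⁅ x * ⁆
  ∁*-∖⁅⁆ X (i , false) = cong₂ _,_ (∁-─ _ _) (∁-─ _ _)
  ∁*-∖⁅⁆ X (i , true)  = cong₂ _,_ (∁-─ _ _) (∁-─ _ _)

∁*-∁*∖∪ : (X : SubE n) (x y : Elt n) → ∁* (∁* X ∖⁅ x ⁆ ∪⁅ y ⁆) ≡ X ∪⁅ x * ⁆ ∖⁅ y * ⁆
∁*-∁*∖∪ X x y = trans (∁*-∪⁅⁆ (∁* X ∖⁅ x ⁆) y)
  (cong (_∖⁅ y * ⁆) (trans (∁*-∖⁅⁆ (∁* X) x) (cong (_∪⁅ x * ⁆) (∁*-involutive X))))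

infix 4 _≟ˢ_ _∈F?_ _⊆?_

_≟ˢ_ : DecidableEquality (SubE n)
_≟ˢ_ = ×ₚ.≡-dec (Vecₚ.≡-dec Boolₚ._≟_) (Vecₚ.≡-dec Boolₚ._≟_)

any?ᵉ : {P : Elt n → Set} → (∀ x → Dec (P x)) → Dec (∃ P)
any?ᵉ P? with Finₚ.any? (λ i → P? (i , false) ⊎-dec P? (i , true))
... | yes (i , inj₁ p) = yes ((i , false) , p)
... | yes (i , inj₂ p) = yes ((i , true) , p)
... | no ¬∃ = no λ where
  ((i , false) , p) → ¬∃ (i , inj₁ p)
  ((i , true)  , p) → ¬∃ (i , inj₂ p)

any?ˢ : {P : SubE n → Set} → (∀ X → Dec (P X)) → Dec (∃ P)
any?ˢ P? with Sₚ.anySubset? (λ p → Sₚ.anySubset? (λ q → P? (p , q)))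
... | yes (p , q , P[p,q]) = yes ((p , q) , P[p,q])
... | no ¬∃ = no λ ((p , q) , P[p,q]) → ¬∃ (p , q , P[p,q])

_∈F?_ : (X : SubE n) (𝓕 : Family n) → Dec (X ∈F 𝓕)
X ∈F? 𝓕 = 𝓕 X Boolₚ.≟ true

_⊆?_ : (X Y : SubE n) → Dec (X ⊆ Y)
X ⊆? Y = map′ ⊆E⇒⊆ ⊆⇒⊆E ((proj₁ X Sₚ.⊆? proj₁ Y) ×-dec (proj₂ X Sₚ.⊆? proj₂ Y))

⊆⊎∃∉ : (X Y : SubE n) → X ⊆ Y ⊎ ∃[ x ] (x ∈ X × x ∉ Y)
⊆⊎∃∉ X Y with any?ᵉ (λ x → x ∈? X ×-dec ¬? (x ∈? Y))
... | yes ∃x = inj₂ ∃x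
... | no ¬∃x = inj₁ λ {x} x∈X → decidable-stable (x ∈? Y) (λ x∉Y → ¬∃x (x , x∈X , x∉Y))

x∈p⇒1≤∣p∣ : {p : Subset n} {i : Fin n} → i S.∈ p → 1 ≤ S.∣ p ∣
x∈p⇒1≤∣p∣ {i = i} i∈p = ≤-trans (≤-reflexive (sym (Sₚ.∣⁅x⁆∣≡1 i)))
  (Sₚ.p⊆q⇒∣p∣≤∣q∣ (λ j∈ → subst (S._∈ _) (sym (Sₚ.x∈⁅y⁆⇒x≡y i j∈)) i∈p))

∣p∣≡0⇒x∉p : {p : Subset n} {i : Fin n} → S.∣ p ∣ ≡ 0 → i S.∉ p
∣p∣≡0⇒x∉p ∣p∣≡0 i∈p = contradiction (≤-trans (x∈p⇒1≤∣p∣ i∈p) (≤-reflexive ∣p∣≡0)) λ ()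

∣p∣≢0⇒nonempty : {p : Subset n} → S.∣ p ∣ ≢ 0 → S.Nonempty p
∣p∣≢0⇒nonempty {n} {p} ∣p∣≢0 with Sₚ.nonempty? p
... | yes ne = ne
... | no ¬ne = contradiction (trans (cong S.∣_∣ (Sₚ.Empty-unique ¬ne)) (Sₚ.∣⊥∣≡0 n)) ∣p∣≢0

p⊆⁅x⁆⇒∣p∣≤1 : {p : Subset n} {i : Fin n} → p S.⊆ ⁅ i ⁆ → S.∣ p ∣ ≤ 1
p⊆⁅x⁆⇒∣p∣≤1 {i = i} p⊆ = ≤-trans (Sₚ.p⊆q⇒∣p∣≤∣q∣ p⊆) (≤-reflexive (Sₚ.∣⁅x⁆∣≡1 i))

∣p∣≡1⇒x≡y : {p : Subset n} {i j : Fin n} → S.∣ p ∣ ≡ 1 → i S.∈ p → j S.∈ p → i ≡ j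
∣p∣≡1⇒x≡y {i = i} {j} ∣p∣≡1 i∈p j∈p with i Finₚ.≟ j
... | yes i≡j = i≡j
... | no  i≢j = contradiction (≤-<-trans (x∈p⇒1≤∣p∣ (Sₚ.x∈p∧x≢y⇒x∈p-y j∈p (i≢j ∘ sym)))
                                          (Sₚ.x∈p⇒∣p-x∣<∣p∣ i∈p))
                              (<-irrefl (sym ∣p∣≡1))

∣p∪⁅x⁆∣≡1+∣p∣ : {p : Subset n} (i : Fin n) → i S.∉ p → S.∣ p S.∪ ⁅ i ⁆ ∣ ≡ suc S.∣ p ∣
∣p∪⁅x⁆∣≡1+∣p∣ {p = true  ∷ p} zero    i∉p = contradiction here i∉p
∣p∪⁅x⁆∣≡1+∣p∣ {p = false ∷ p} zero    i∉p = cong (suc ∘ S.∣_∣) (Sₚ.∪-identityʳ p)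
∣p∪⁅x⁆∣≡1+∣p∣ {p = true  ∷ p} (suc i) i∉p = cong suc (∣p∪⁅x⁆∣≡1+∣p∣ i (Sₚ.drop-not-there i∉p))
∣p∪⁅x⁆∣≡1+∣p∣ {p = false ∷ p} (suc i) i∉p = ∣p∪⁅x⁆∣≡1+∣p∣ i (Sₚ.drop-not-there i∉p)

-- Each index contributes |{i, i*} ∩ X| + [i missing] = 1 + [i skew].
∣p∣+∣q∣+∣∁q∩∁p∣≡n+∣p∩q∣ : (p q : Subset n) →
  S.∣ p ∣ + S.∣ q ∣ + S.∣ ∁ q S.∩ ∁ p ∣ ≡ n + S.∣ p S.∩ q ∣
∣p∣+∣q∣+∣∁q∩∁p∣≡n+∣p∩q∣ []          []          = refl
∣p∣+∣q∣+∣∁q∩∁p∣≡n+∣p∩q∣ {suc n} (true ∷ p) (true ∷ q) = cong suc (begin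
  S.∣ p ∣ + suc S.∣ q ∣ + r     ≡⟨ cong (_+ r) (+-suc S.∣ p ∣ S.∣ q ∣) ⟩
  suc (S.∣ p ∣ + S.∣ q ∣ + r)   ≡⟨ cong suc (∣p∣+∣q∣+∣∁q∩∁p∣≡n+∣p∩q∣ p q) ⟩
  suc (n + S.∣ p S.∩ q ∣)       ≡⟨ +-suc n _ ⟨
  n + suc S.∣ p S.∩ q ∣         ∎)
  where open ≡-Reasoning; r = S.∣ ∁ q S.∩ ∁ p ∣
∣p∣+∣q∣+∣∁q∩∁p∣≡n+∣p∩q∣ (true  ∷ p) (false ∷ q) = cong suc (∣p∣+∣q∣+∣∁q∩∁p∣≡n+∣p∩q∣ p q)
∣p∣+∣q∣+∣∁q∩∁p∣≡n+∣p∩q∣ (false ∷ p) (true  ∷ q) =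
  trans (cong (_+ S.∣ ∁ q S.∩ ∁ p ∣) (+-suc S.∣ p ∣ S.∣ q ∣)) (cong suc (∣p∣+∣q∣+∣∁q∩∁p∣≡n+∣p∩q∣ p q))
∣p∣+∣q∣+∣∁q∩∁p∣≡n+∣p∩q∣ (false ∷ p) (false ∷ q) =
  trans (+-suc _ _) (cong suc (∣p∣+∣q∣+∣∁q∩∁p∣≡n+∣p∩q∣ p q))

opaque
  unfolding _∪⁅_⁆

  card-∪⁅⁆ : {X : SubE n} {x : Elt n} → x ∉ X → card (X ∪⁅ x ⁆) ≡ suc (card X)
  card-∪⁅⁆ {X = p , q} {i , false} x∉ =
    cong₂ _+_ (∣p∪⁅x⁆∣≡1+∣p∣ i (x∉ ∘ ∈E⇒∈ (i , false))) (cong S.∣_∣ (Sₚ.∪-identityʳ q))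
  card-∪⁅⁆ {X = p , q} {i , true}  x∉ =
    trans (cong₂ _+_ (cong S.∣_∣ (Sₚ.∪-identityʳ p)) (∣p∪⁅x⁆∣≡1+∣p∣ i (x∉ ∘ ∈E⇒∈ (i , true))))
          (+-suc S.∣ p ∣ S.∣ q ∣)

card-∖⁅⁆ : {X : SubE n} {x : Elt n} → x ∈ X → suc (card (X ∖⁅ x ⁆)) ≡ card X
card-∖⁅⁆ x∈ = trans (sym (card-∪⁅⁆ ∉-∖⁅⁆-self)) (cong card (∖⁅⁆-∪⁅⁆ x∈))

card-mono : {X Y : SubE n} → X ⊆ Y → card X ≤ card Y
card-mono X⊆Y with ⊆⇒⊆E X⊆Y
... | sub₁ , sub₂ = +-mono-≤ (Sₚ.p⊆q⇒∣p∣≤∣q∣ sub₁) (Sₚ.p⊆q⇒∣p∣≤∣q∣ sub₂)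

card-sing : (x : Elt n) → card (sing x) ≡ 1
card-sing {n} (i , false) = cong₂ _+_ (Sₚ.∣⁅x⁆∣≡1 i) (Sₚ.∣⊥∣≡0 n)
card-sing {n} (i , true)  = cong₂ _+_ (Sₚ.∣⊥∣≡0 n) (Sₚ.∣⁅x⁆∣≡1 i)

Singleton : SubE n → Elt n → Set
Singleton Z x = x ∈ Z × (∀ {y} → y ∈ Z → y ≡ x)

Singleton⇒card≡1 : {Z : SubE n} {x : Elt n} → Singleton Z x → card Z ≡ 1
Singleton⇒card≡1 {x = x} (x∈ , unique) = trans (cong card Z≡sing) (card-sing x)
  where
  Z≡sing = ⊆-antisym (λ y∈ → subst (_∈ sing x) (sym (unique y∈)) (∈ᵇ⇒∈ (∈ᵇ-sing-self x)))
                     (λ y∈ → subst (_∈ _) (sym (∈-sing⇒≡ y∈)) x∈)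

card≡1⇒Singleton : {Z : SubE n} → card Z ≡ 1 → ∃ (Singleton Z)
card≡1⇒Singleton {Z = p , q} ≡1 with S.∣ p ∣ in ∣p∣≡ | S.∣ q ∣ in ∣q∣≡ | ≡1
... | 1 | 0 | _ with ∣p∣≢0⇒nonempty {p = p} (1+n≢0 ∘ trans (sym ∣p∣≡))
...   | i , i∈p = (i , false) , ∈E⇒∈ (i , false) i∈p , unique
  where
  unique : ∀ {y} → y ∈ (p , q) → y ≡ (i , false)
  unique {j , false} j∈ = cong (_, false) (∣p∣≡1⇒x≡y ∣p∣≡ (∈⇒∈E (j , false) j∈) i∈p)
  unique {j , true}  j∈ = contradiction (∈⇒∈E (j , true) j∈) (∣p∣≡0⇒x∉p ∣q∣≡)
card≡1⇒Singleton {Z = p , q} ≡1 | 0 | 1 | _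
  with ∣p∣≢0⇒nonempty {p = q} (1+n≢0 ∘ trans (sym ∣q∣≡))
...   | i , i∈q = (i , true) , ∈E⇒∈ (i , true) i∈q , unique
  where
  unique : ∀ {y} → y ∈ (p , q) → y ≡ (i , true)
  unique {j , false} j∈ = contradiction (∈⇒∈E (j , false) j∈) (∣p∣≡0⇒x∉p ∣p∣≡)
  unique {j , true}  j∈ = cong (_, true) (∣p∣≡1⇒x≡y ∣q∣≡ (∈⇒∈E (j , true) j∈) i∈q)

-- Skew pairs and missing pairs

SkewIn : SubE n → Fin n → Set
SkewIn X i = (i , false) ∈ X × (i , true) ∈ X

-- Neither i nor i* lies in X.
Missing : SubE n → Fin n → Set
Missing X = SkewIn (∁* X)

missingCount : SubE n → ℕ
missingCount X = skewCount (∁* X)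

skewIn? : (X : SubE n) (i : Fin n) → Dec (SkewIn X i)
skewIn? X i = ((i , false) ∈? X) ×-dec ((i , true) ∈? X)

SkewIn⇒∈ : {X : SubE n} {i : Fin n} → SkewIn X i → (b : Bool) → (i , b) ∈ X
SkewIn⇒∈ (i∈ , _)  false = i∈
SkewIn⇒∈ (_ , i*∈) true  = i*∈

∈⇒SkewIn : {X : SubE n} {x : Elt n} → x ∈ X → x * ∈ X → SkewIn X (proj₁ x)
∈⇒SkewIn {x = i , false} x∈ x*∈ = x∈ , x*∈
∈⇒SkewIn {x = i , true}  x∈ x*∈ = x*∈ , x∈

Missing⇒∉ : {X : SubE n} {i : Fin n} → Missing X i → (b : Bool) → (i , b) ∉ X
Missing⇒∉ {X = X} m false = ∈-∁*⁻ X (SkewIn⇒∈ m true)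
Missing⇒∉ {X = X} m true  = ∈-∁*⁻ X (SkewIn⇒∈ m false)

∉⇒Missing : {X : SubE n} {x : Elt n} → x ∉ X → x * ∉ X → Missing X (proj₁ x)
∉⇒Missing {x = i , false} x∉ x*∉ = ∈-∁*⁺ x*∉ , ∈-∁*⁺ x∉
∉⇒Missing {x = i , true}  x∉ x*∉ = ∈-∁*⁺ x∉ , ∈-∁*⁺ x*∉

SkewIn⇒∈pairs : {X : SubE n} {i : Fin n} → SkewIn X i → i S.∈ proj₁ X S.∩ proj₂ X
SkewIn⇒∈pairs {i = i} (i∈ , i*∈) = Sₚ.x∈p∩q⁺ (∈⇒∈E (i , false) i∈ , ∈⇒∈E (i , true) i*∈)

∈pairs⇒SkewIn : {X : SubE n} {i : Fin n} → i S.∈ proj₁ X S.∩ proj₂ X → SkewIn X i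
∈pairs⇒SkewIn {X = X} {i} i∈ with Sₚ.x∈p∩q⁻ (proj₁ X) (proj₂ X) i∈
... | i∈₁ , i∈₂ = ∈E⇒∈ (i , false) i∈₁ , ∈E⇒∈ (i , true) i∈₂

SkewIn⇒1≤skewCount : {X : SubE n} {i : Fin n} → SkewIn X i → 1 ≤ skewCount X
SkewIn⇒1≤skewCount = x∈p⇒1≤∣p∣ ∘ SkewIn⇒∈pairs

skewCount≡0⇒¬SkewIn : {X : SubE n} {i : Fin n} → skewCount X ≡ 0 → ¬ SkewIn X i
skewCount≡0⇒¬SkewIn ≡0 = ∣p∣≡0⇒x∉p ≡0 ∘ SkewIn⇒∈pairs

¬SkewIn⇒skewCount≡0 : {X : SubE n} → (∀ i → ¬ SkewIn X i) → skewCount X ≡ 0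
¬SkewIn⇒skewCount≡0 {n} none =
  trans (cong S.∣_∣ (Sₚ.Empty-unique λ (i , i∈) → none i (∈pairs⇒SkewIn i∈))) (Sₚ.∣⊥∣≡0 n)

skewCount≢0⇒SkewIn : {X : SubE n} → skewCount X ≢ 0 → ∃ (SkewIn X)
skewCount≢0⇒SkewIn ≢0 with ∣p∣≢0⇒nonempty ≢0
... | i , i∈ = i , ∈pairs⇒SkewIn i∈

skewCount≡1⇒SkewIn : {X : SubE n} → skewCount X ≡ 1 → ∃ (SkewIn X)
skewCount≡1⇒SkewIn ≡1 = skewCount≢0⇒SkewIn (1+n≢0 ∘ trans (sym ≡1))

skewCount≡1⇒SkewIn-unique : {X : SubE n} {i j : Fin n} →
  skewCount X ≡ 1 → SkewIn X i → SkewIn X j → i ≡ j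
skewCount≡1⇒SkewIn-unique ≡1 i∈ j∈ = ∣p∣≡1⇒x≡y ≡1 (SkewIn⇒∈pairs i∈) (SkewIn⇒∈pairs j∈)

skewCount≤1 : {X : SubE n} {i : Fin n} → (∀ {j} → SkewIn X j → j ≡ i) → skewCount X ≤ 1
skewCount≤1 {i = i} unique =
  p⊆⁅x⁆⇒∣p∣≤1 λ j∈ → subst (S._∈ ⁅ i ⁆) (sym (unique (∈pairs⇒SkewIn j∈))) (Sₚ.x∈⁅x⁆ i)

SkewIn⇒skewCount≡1 : {X : SubE n} {i : Fin n} → skewCount X ≤ 1 → SkewIn X i → skewCount X ≡ 1
SkewIn⇒skewCount≡1 skew≤1 i∈ = ≤-antisym skew≤1 (SkewIn⇒1≤skewCount i∈)

skewCount≡1 : {X : SubE n} {i : Fin n} → SkewIn X i → (∀ {j} → SkewIn X j → j ≡ i) → skewCount X ≡ 1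
skewCount≡1 i∈ unique = SkewIn⇒skewCount≡1 (skewCount≤1 unique) i∈

skewCount-mono : {X Y : SubE n} → X ⊆ Y → skewCount X ≤ skewCount Y
skewCount-mono X⊆Y = Sₚ.p⊆q⇒∣p∣≤∣q∣ λ i∈ →
  SkewIn⇒∈pairs (Data.Product.map X⊆Y X⊆Y (∈pairs⇒SkewIn i∈))

skewFree⇒⊆∁* : {X : SubE n} → skewCount X ≡ 0 → X ⊆ ∁* X
skewFree⇒⊆∁* skew≡0 x∈ = ∈-∁*⁺ λ x*∈ → skewCount≡0⇒¬SkewIn skew≡0 (∈⇒SkewIn x∈ x*∈)

SkewIn-∪⁅⁆ : {X : SubE n} {x : Elt n} {j : Fin n} → SkewIn (X ∪⁅ x ⁆) j → j ≢ proj₁ x → SkewIn X j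
SkewIn-∪⁅⁆ (j∈ , j*∈) j≢ = ∈-∪⁅⁆-≢ j∈ (j≢ ∘ cong proj₁) , ∈-∪⁅⁆-≢ j*∈ (j≢ ∘ cong proj₁)

SkewIn-∖⁅⁆ : {X : SubE n} {x : Elt n} {j : Fin n} → SkewIn (X ∖⁅ x ⁆) j → SkewIn X j
SkewIn-∖⁅⁆ (j∈ , j*∈) = ∖⁅⁆-⊆ j∈ , ∖⁅⁆-⊆ j*∈

skewCount-∪⁅⁆ : {X : SubE n} {x : Elt n} → x * ∉ X → skewCount (X ∪⁅ x ⁆) ≡ skewCount X
skewCount-∪⁅⁆ {X = X} {x} x*∉ = cong S.∣_∣ (Sₚ.⊆-antisym
  (λ i∈ → SkewIn⇒∈pairs {X = X} (shrink (∈pairs⇒SkewIn {X = X ∪⁅ x ⁆} i∈)))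
  (λ i∈ → SkewIn⇒∈pairs {X = X ∪⁅ x ⁆} (Data.Product.map ⊆-∪⁅⁆ ⊆-∪⁅⁆ (∈pairs⇒SkewIn {X = X} i∈))))
  where
  shrink : ∀ {j} → SkewIn (X ∪⁅ x ⁆) j → SkewIn X j
  shrink {j} s with j Finₚ.≟ proj₁ x
  ... | no  j≢ = SkewIn-∪⁅⁆ s j≢
  ... | yes refl with ∈-∪⁅⁆⁻ (SkewIn⇒∈ s (not (proj₂ x)))
  ...   | inj₁ x*≡x = contradiction x*≡x (*-≢ x)
  ...   | inj₂ x*∈  = contradiction x*∈ x*∉

SkewIn-∪⁅⁆-unique : {X : SubE n} {x : Elt n} {j : Fin n} →
  skewCount X ≡ 0 → SkewIn (X ∪⁅ x ⁆) j → j ≡ proj₁ x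
SkewIn-∪⁅⁆-unique {x = x} {j} ≡0 s with j Finₚ.≟ proj₁ x
... | yes j≡ = j≡
... | no  j≢ = contradiction (SkewIn-∪⁅⁆ s j≢) (skewCount≡0⇒¬SkewIn ≡0)

skewCount-∪⁅⁆≤1 : {X : SubE n} {x : Elt n} → skewCount X ≡ 0 → skewCount (X ∪⁅ x ⁆) ≤ 1
skewCount-∪⁅⁆≤1 ≡0 = skewCount≤1 (SkewIn-∪⁅⁆-unique ≡0)

skewCount-∪⁅⁆≡1 : {X : SubE n} {x : Elt n} → skewCount X ≡ 0 → x * ∈ X → skewCount (X ∪⁅ x ⁆) ≡ 1
skewCount-∪⁅⁆≡1 ≡0 x*∈ = skewCount≡1 (∈⇒SkewIn ∈-∪⁅⁆-self (⊆-∪⁅⁆ x*∈)) (SkewIn-∪⁅⁆-unique ≡0)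

skewCount-∖⁅⁆≡0 : {X : SubE n} {x : Elt n} → skewCount X ≡ 1 → x ∈ X → x * ∈ X → skewCount (X ∖⁅ x ⁆) ≡ 0
skewCount-∖⁅⁆≡0 {x = x} ≡1 x∈ x*∈ = ¬SkewIn⇒skewCount≡0 λ j s →
  case skewCount≡1⇒SkewIn-unique ≡1 (SkewIn-∖⁅⁆ s) (∈⇒SkewIn x∈ x*∈) of λ where
    refl → ∉-∖⁅⁆-self (SkewIn⇒∈ s (proj₂ x))

opaque
  unfolding ∁*

  card+missingCount≡n+skewCount : (X : SubE n) → card X + missingCount X ≡ n + skewCount X
  card+missingCount≡n+skewCount (p , q) = ∣p∣+∣q∣+∣∁q∩∁p∣≡n+∣p∩q∣ p q

card≡n⇒missingCount≡skewCount : {X : SubE n} → card X ≡ n → missingCount X ≡ skewCount X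
card≡n⇒missingCount≡skewCount {n} {X} card≡n =
  +-cancelˡ-≡ n _ _ (trans (cong (_+ missingCount X) (sym card≡n)) (card+missingCount≡n+skewCount X))

card≡1+n⇒missingCount≡0 : {X : SubE n} → card X ≡ suc n → skewCount X ≡ 1 → missingCount X ≡ 0
card≡1+n⇒missingCount≡0 {n} {X} card≡ skew≡1 = +-cancelˡ-≡ (suc n) _ _ (begin
  suc n + missingCount X  ≡⟨ cong (_+ missingCount X) card≡ ⟨
  card X + missingCount X ≡⟨ card+missingCount≡n+skewCount X ⟩
  n + skewCount X         ≡⟨ cong (n +_) skew≡1 ⟩
  n + 1                   ≡⟨ +-comm n 1 ⟩
  suc n                   ≡⟨ +-identityʳ (suc n) ⟨
  suc n + 0               ∎)
  where open ≡-Reasoning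

missingCount-skewFree : {X : SubE n} {k : ℕ} → skewCount X ≡ 0 → card X + k ≡ n → missingCount X ≡ k
missingCount-skewFree {n} {X} skew≡0 card+k≡n = +-cancelˡ-≡ (card X) _ _ (begin
  card X + missingCount X ≡⟨ card+missingCount≡n+skewCount X ⟩
  n + skewCount X         ≡⟨ cong (n +_) skew≡0 ⟩
  n + 0                   ≡⟨ +-identityʳ n ⟩
  n                       ≡⟨ card+k≡n ⟨
  card X + _              ∎)
  where open ≡-Reasoning

skewCount-∁*∖⁅*⁆≡0 : {X : SubE n} {x : Elt n} → card X ≡ n → x ∉ X → skewCount (X ∪⁅ x ⁆) ≡ 1 →
                      skewCount (∁* X ∖⁅ x * ⁆) ≡ 0
skewCount-∁*∖⁅*⁆≡0 {X = X} {x} card≡n x∉ skew≡1 = trans (cong skewCount (sym (∁*-∪⁅⁆ X x)))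
  (card≡1+n⇒missingCount≡0 (trans (card-∪⁅⁆ x∉) (cong suc card≡n)) skew≡1)

card-∁* : {X : SubE n} → card X ≡ n → card (∁* X) ≡ n
card-∁* {n} {X} card≡n = +-cancelʳ-≡ (skewCount X) _ _ (begin
  card (∁* X) + skewCount X           ≡⟨ cong (λ Y → card (∁* X) + skewCount Y) (∁*-involutive X) ⟨
  card (∁* X) + missingCount (∁* X)   ≡⟨ card+missingCount≡n+skewCount (∁* X) ⟩
  n + missingCount X                  ≡⟨ cong (n +_) (card≡n⇒missingCount≡skewCount card≡n) ⟩
  n + skewCount X                     ∎)
  where open ≡-Reasoning

-- Transversals and almost-transversals

Transversal-∈⇒*∉ : {T : SubE n} {x : Elt n} → Transversal T → x ∈ T → x * ∉ T
Transversal-∈⇒*∉ (_ , skew≡0) x∈ x*∈ = skewCount≡0⇒¬SkewIn skew≡0 (∈⇒SkewIn x∈ x*∈)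

Transversal-∉⇒*∈ : {T : SubE n} {x : Elt n} → Transversal T → x ∉ T → x * ∈ T
Transversal-∉⇒*∈ {T = T} {x} (card≡n , skew≡0) x∉ with x * ∈? T
... | yes x*∈ = x*∈
... | no  x*∉ = contradiction (∉⇒Missing x∉ x*∉)
                  (skewCount≡0⇒¬SkewIn (trans (card≡n⇒missingCount≡skewCount card≡n) skew≡0))

∁*-Transversal : {T : SubE n} → Transversal T → ∁* T ≡ T
∁*-Transversal {T = T} tr = ⊆-antisym
  (λ {y} y∈ → subst (_∈ T) (*-involutive y) (Transversal-∉⇒*∈ tr (∈-∁*⁻ T y∈)))
  (λ y∈ → ∈-∁*⁺ (Transversal-∈⇒*∉ tr y∈))

∈ᵇ-swap-at-removed : (X : SubE n) (p q : Fin n) (b : Bool) →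
                     (q , b) ∈ᵇ (X ∪E skew p) ∖E skew q ≡ false
∈ᵇ-swap-at-removed X p q b = trans (∈ᵇ-∖ (q , b) _ (skew q))
  (trans (cong (λ c → ((q , b) ∈ᵇ X ∪E skew p) ∧ not c) (∈ᵇ-skew-self q b)) (Boolₚ.∧-zeroʳ _))

∈ᵇ-swap-at-added : (X : SubE n) {p q : Fin n} (b : Bool) → p ≢ q →
                   (p , b) ∈ᵇ (X ∪E skew p) ∖E skew q ≡ true
∈ᵇ-swap-at-added X {p} {q} b p≢q = begin
  (p , b) ∈ᵇ (X ∪E skew p) ∖E skew q
    ≡⟨ ∈ᵇ-∖ (p , b) _ (skew q) ⟩
  ((p , b) ∈ᵇ X ∪E skew p) ∧ not ((p , b) ∈ᵇ skew q)
    ≡⟨ cong₂ (λ c d → c ∧ not d) (∈ᵇ-∪ (p , b) X (skew p)) (∈ᵇ-skew-≢ b p≢q) ⟩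
  (((p , b) ∈ᵇ X) ∨ ((p , b) ∈ᵇ skew p)) ∧ true
    ≡⟨ cong (λ c → (((p , b) ∈ᵇ X) ∨ c) ∧ true) (∈ᵇ-skew-self p b) ⟩
  (((p , b) ∈ᵇ X) ∨ true) ∧ true
    ≡⟨ cong (_∧ true) (Boolₚ.∨-zeroʳ _) ⟩
  true
    ∎
  where open ≡-Reasoning

∈ᵇ-swap-elsewhere : (X : SubE n) {p q j : Fin n} (b : Bool) → j ≢ p → j ≢ q →
                    (j , b) ∈ᵇ (X ∪E skew p) ∖E skew q ≡ (j , b) ∈ᵇ X
∈ᵇ-swap-elsewhere X {p} {q} {j} b j≢p j≢q = begin
  (j , b) ∈ᵇ (X ∪E skew p) ∖E skew q
    ≡⟨ ∈ᵇ-∖ (j , b) _ (skew q) ⟩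
  ((j , b) ∈ᵇ X ∪E skew p) ∧ not ((j , b) ∈ᵇ skew q)
    ≡⟨ cong₂ (λ c d → c ∧ not d) (∈ᵇ-∪ (j , b) X (skew p)) (∈ᵇ-skew-≢ b j≢q) ⟩
  (((j , b) ∈ᵇ X) ∨ ((j , b) ∈ᵇ skew p)) ∧ true
    ≡⟨ cong (λ c → (((j , b) ∈ᵇ X) ∨ c) ∧ true) (∈ᵇ-skew-≢ b j≢p) ⟩
  (((j , b) ∈ᵇ X) ∨ false) ∧ true
    ≡⟨ trans (Boolₚ.∧-identityʳ _) (Boolₚ.∨-identityʳ _) ⟩
  (j , b) ∈ᵇ X
    ∎
  where open ≡-Reasoning

∁*-swap : {T : SubE n} {p q : Fin n} → Transversal T → p ≢ q →
          ∁* ((T ∪E skew p) ∖E skew q) ≡ (T ∪E skew q) ∖E skew p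
∁*-swap {T = T} {p} {q} tr p≢q =
  ext λ (j , b) → trans (∈ᵇ-∁* (j , b) ((T ∪E skew p) ∖E skew q)) (pointwise j b)
  where
  T-at : ∀ j b → not ((j , not b) ∈ᵇ T) ≡ (j , b) ∈ᵇ T
  T-at j b = trans (sym (∈ᵇ-∁* (j , b) T)) (cong ((j , b) ∈ᵇ_) (∁*-Transversal tr))
  pointwise : ∀ j b → not ((j , not b) ∈ᵇ (T ∪E skew p) ∖E skew q) ≡ (j , b) ∈ᵇ (T ∪E skew q) ∖E skew p
  pointwise j b with j Finₚ.≟ p | j Finₚ.≟ q
  ... | yes refl | yes refl = contradiction refl p≢q
  ... | yes refl | no _     =
    trans (cong not (∈ᵇ-swap-at-added T (not b) p≢q)) (sym (∈ᵇ-swap-at-removed T q j b))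
  ... | no _     | yes refl =
    trans (cong not (∈ᵇ-swap-at-removed T p j (not b))) (sym (∈ᵇ-swap-at-added T b (p≢q ∘ sym)))
  ... | no j≢p   | no j≢q   =
    trans (cong not (∈ᵇ-swap-elsewhere T (not b) j≢p j≢q))
          (trans (T-at j b) (sym (∈ᵇ-swap-elsewhere T b j≢q j≢p)))

AlmostTransversal⇒swap : {B : SubE n} → AlmostTransversal B →
  ∃[ T ] ∃[ p ] ∃[ q ] (Transversal T × p ≢ q × B ≡ (T ∪E skew p) ∖E skew q)
AlmostTransversal⇒swap {n} {B} (card≡n , skew≡1)
  with skewCount≡1⇒SkewIn {X = B} skew≡1
     | skewCount≡1⇒SkewIn {X = ∁* B} (trans (card≡n⇒missingCount≡skewCount card≡n) skew≡1)
... | p , p∈ | q , q∉ = T , p , q , (card-T , skew-T) , p≢q , ext pointwise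
  where
  T : SubE n
  T = B ∖⁅ (p , true) ⁆ ∪⁅ (q , false) ⁆
  p≢q : p ≢ q
  p≢q refl = Missing⇒∉ q∉ false (proj₁ p∈)
  card-T : card T ≡ n
  card-T = trans (card-∪⁅⁆ (Missing⇒∉ q∉ false ∘ ∖⁅⁆-⊆)) (trans (card-∖⁅⁆ (proj₂ p∈)) card≡n)
  skew-T : skewCount T ≡ 0
  skew-T = trans (skewCount-∪⁅⁆ (Missing⇒∉ q∉ true ∘ ∖⁅⁆-⊆)) (skewCount-∖⁅⁆≡0 skew≡1 (proj₂ p∈) (proj₁ p∈))
  pointwise : ∀ y → y ∈ᵇ B ≡ y ∈ᵇ (T ∪E skew p) ∖E skew q
  pointwise (j , b) with j Finₚ.≟ p | j Finₚ.≟ q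
  ... | yes refl | _        = trans (∈⇒∈ᵇ (SkewIn⇒∈ p∈ b)) (sym (∈ᵇ-swap-at-added T b p≢q))
  ... | no _     | yes refl = trans (∉⇒∈ᵇ (Missing⇒∉ q∉ b)) (sym (∈ᵇ-swap-at-removed T p j b))
  ... | no j≢p   | no j≢q   = sym (begin
    (j , b) ∈ᵇ (T ∪E skew p) ∖E skew q
      ≡⟨ ∈ᵇ-swap-elsewhere T b j≢p j≢q ⟩
    (j , b) ∈ᵇ T
      ≡⟨ ∈ᵇ-∪⁅⁆-≢ (j , b) (B ∖⁅ (p , true) ⁆) (q , false) (j≢q ∘ cong proj₁) ⟩
    (j , b) ∈ᵇ B ∖⁅ (p , true) ⁆
      ≡⟨ ∈ᵇ-∖⁅⁆-≢ (j , b) B (p , true) (j≢p ∘ cong proj₁) ⟩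
    (j , b) ∈ᵇ B
      ∎)
    where open ≡-Reasoning

-- Orthogonality

infix 4 _∩*_≡⁅_⁆

_∩*_≡⁅_⁆ : SubE n → SubE n → Elt n → Set
X ∩* Y ≡⁅ e ⁆ = e ∈ X × e * ∈ Y × (∀ {y} → y ∈ X → y * ∈ Y → y ≡ e)

card-∩star≡1⇒∩*≡⁅⁆ : {X Y : SubE n} → card (X ∩E star Y) ≡ 1 → ∃ (X ∩* Y ≡⁅_⁆)
card-∩star≡1⇒∩*≡⁅⁆ {X = X} {Y} card≡1 with card≡1⇒Singleton card≡1
... | e , e∈ , unique = e , proj₁ (∈-∩⁻ X (star Y) e∈) , ∈-star⁻ Y (proj₂ (∈-∩⁻ X (star Y) e∈)) ,
                        λ y∈X y*∈Y → unique (∈-∩⁺ y∈X (∈-star⁺ y*∈Y))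

∩*≡⁅⁆⇒card-∩star≡1 : {X Y : SubE n} {e : Elt n} → X ∩* Y ≡⁅ e ⁆ → card (X ∩E star Y) ≡ 1
∩*≡⁅⁆⇒card-∩star≡1 {X = X} {Y} (e∈X , e*∈Y , unique) =
  Singleton⇒card≡1 (∈-∩⁺ e∈X (∈-star⁺ e*∈Y) , λ y∈ →
    unique (proj₁ (∈-∩⁻ X (star Y) y∈)) (∈-star⁻ Y (proj₂ (∈-∩⁻ X (star Y) y∈))))

∩*-⊆⁅⁆ : {C D X : SubE n} {z y : Elt n} → C ⊆ X ∪⁅ z ⁆ → D ⊆ ∁* X ∪⁅ z * ⁆ → y ∈ C → y * ∈ D → y ≡ z
∩*-⊆⁅⁆ {X = X} C⊆ D⊆ y∈C y*∈D with ∈-∪⁅⁆⁻ (C⊆ y∈C) | ∈-∪⁅⁆⁻ (D⊆ y*∈D)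
... | inj₁ y≡z | _              = y≡z
... | inj₂ _   | inj₁ y*≡z*     = *-injective y*≡z*
... | inj₂ y∈X | inj₂ y*∈∁*X   = contradiction (subst (_∈ X) (sym (*-involutive _)) y∈X) (∈-∁*⁻ X y*∈∁*X)

¬∩*≡⁅⁆⇒∃ : {X Y : SubE n} {e : Elt n} → e ∈ X → e * ∈ Y → ¬ (X ∩* Y ≡⁅ e ⁆) →
           ∃[ f ] (f ∈ X × f * ∈ Y × f ≢ e)
¬∩*≡⁅⁆⇒∃ {X = X} {Y} {e} e∈X e*∈Y ¬single
  with any?ᵉ (λ f → f ∈? X ×-dec f * ∈? Y ×-dec ¬? (f ≟ᵉ e))
... | yes found = found
... | no  ¬found = ⊥-elim (¬single (e∈X , e*∈Y , unique))
  where
  unique : ∀ {y} → y ∈ X → y * ∈ Y → y ≡ e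
  unique {y} y∈X y*∈Y = decidable-stable (y ≟ᵉ e) λ y≢e → ¬found (y , y∈X , y*∈Y , y≢e)

module CircuitsOfMatroid {n : ℕ} {𝓑 : Family n} (M : IsAntisymmetricMatroid 𝓑) where

  open IsAntisymmetricMatroid M

  Circuit : SubE n → Set
  Circuit = IsCircuit 𝓑

  Independent : SubE n → Set
  Independent X = ∃[ B ] (B ∈F 𝓑 × X ⊆ B)

  independent? : (X : SubE n) → Dec (Independent X)
  independent? X = any?ˢ (λ B → B ∈F? 𝓑 ×-dec X ⊆? B)

  ¬Independent⇒NotInAnyBasis : {X : SubE n} → ¬ Independent X → NotInAnyBasis 𝓑 X
  ¬Independent⇒NotInAnyBasis ¬ind B B∈ X⊆B = ¬ind (B , B∈ , ⊆E⇒⊆ X⊆B)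

  NotInAnyBasis⇒¬Independent : {X : SubE n} → NotInAnyBasis 𝓑 X → ¬ Independent X
  NotInAnyBasis⇒¬Independent nib (B , B∈ , X⊆B) = nib B B∈ (⊆⇒⊆E X⊆B)

  opaque
    unfolding _∪⁅_⁆ _∖⁅_⁆

    exchange : {B B′ : SubE n} {e : Elt n} → B ∈F 𝓑 → B′ ∈F 𝓑 → e ∈ B → e ∉ B′ →
               skewCount (B ∖⁅ e ⁆) ≡ 0 → skewCount (B′ ∪⁅ e ⁆) ≡ 1 →
               ∃[ f ] (f ∈ B′ × f ∉ B × B ∖⁅ e ⁆ ∪⁅ f ⁆ ∈F 𝓑 × B′ ∪⁅ e ⁆ ∖⁅ f ⁆ ∈F 𝓑)
    exchange {B} {B′} {e} B∈ B′∈ e∈B e∉B′ skew≡0 skew≡1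
      with Exch B B′ B∈ B′∈ e (∈⇒∈E e e∈B) (e∉B′ ∘ ∈E⇒∈ e) skew≡0 skew≡1
    ... | f , f∈B′ , f∉B , B₁∈ , B₂∈ = f , ∈E⇒∈ f f∈B′ , f∉B ∘ ∈⇒∈E f , B₁∈ , B₂∈

  basis-card : {B : SubE n} → B ∈F 𝓑 → card B ≡ n
  basis-card B∈ with bases-shape _ B∈
  ... | inj₁ (card≡n , _) = card≡n
  ... | inj₂ (card≡n , _) = card≡n

  basis-skewCount≤1 : {B : SubE n} → B ∈F 𝓑 → skewCount B ≤ 1
  basis-skewCount≤1 B∈ with bases-shape _ B∈
  ... | inj₁ (_ , skew≡0) = ≤-trans (≤-reflexive skew≡0) z≤n
  ... | inj₂ (_ , skew≡1) = ≤-reflexive skew≡1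

  ∁*-basis : {B : SubE n} → B ∈F 𝓑 → ∁* B ∈F 𝓑
  ∁*-basis {B} B∈ with bases-shape B B∈
  ... | inj₁ tr = subst (_∈F 𝓑) (sym (∁*-Transversal tr)) B∈
  ... | inj₂ at with AlmostTransversal⇒swap {B = B} at
  ...   | T , p , q , tr , p≢q , refl = subst (_∈F 𝓑) (sym (∁*-swap tr p≢q)) (proj₁ (B2 T tr p q p≢q) B∈)

  ¬Circuit∅ : ¬ Circuit ∅
  ¬Circuit∅ (_ , nib , _) = nib (proj₁ B1) (proj₂ B1) (⊆⇒⊆E (⊥-elim ∘ ∉∅))

  Circuit-⊆⇒≡ : {C₁ C₂ : SubE n} → Circuit C₁ → Circuit C₂ → C₁ ⊆E C₂ → C₁ ≡ C₂
  Circuit-⊆⇒≡ {C₁} {C₂} (skew≤1 , nib , _) (_ , _ , minimal₂) C₁⊆C₂ with C₁ ≟ˢ C₂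
  ... | yes C₁≡C₂ = C₁≡C₂
  ... | no  C₁≢C₂ = contradiction nib (minimal₂ C₁ C₁⊆C₂ C₁≢C₂ skew≤1)

  Circuit⇒¬Independent : {C : SubE n} → Circuit C → ¬ Independent C
  Circuit⇒¬Independent (_ , nib , _) = NotInAnyBasis⇒¬Independent nib

  Circuit-∖⁅⁆-Independent : {C : SubE n} {x : Elt n} → Circuit C → x ∈ C → Independent (C ∖⁅ x ⁆)
  Circuit-∖⁅⁆-Independent {C} {x} (skew≤1 , _ , minimal) x∈C =
    decidable-stable (independent? (C ∖⁅ x ⁆)) λ ¬ind →
      minimal (C ∖⁅ x ⁆) (⊆⇒⊆E ∖⁅⁆-⊆) (λ C∖x≡C → ∉-∖⁅⁆-self (subst (x ∈_) (sym C∖x≡C) x∈C))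
              (≤-trans (skewCount-mono ∖⁅⁆-⊆) skew≤1) (¬Independent⇒NotInAnyBasis ¬ind)

  Circuit-∖⁅⁆⊆basis⇒∉ : {C B : SubE n} {x : Elt n} → Circuit C → B ∈F 𝓑 → C ∖⁅ x ⁆ ⊆ B → x ∉ B
  Circuit-∖⁅⁆⊆basis⇒∉ circ B∈ C∖x⊆B x∈B = Circuit⇒¬Independent circ (_ , B∈ , ∖⁅⁆⊆⇒⊆ C∖x⊆B x∈B)

  n<card⇒¬Independent : {X : SubE n} → n < card X → ¬ Independent X
  n<card⇒¬Independent n<card (B , B∈ , X⊆B) =
    <⇒≱ n<card (≤-trans (card-mono X⊆B) (≤-reflexive (basis-card B∈)))

  -- By induction on k = |X|: drop elements while the set stays dependent.
  ¬Independent⇒⊇Circuit : (k : ℕ) {X : SubE n} → card X ≡ k → skewCount X ≤ 1 → ¬ Independent X →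
                           ∃[ C ] (Circuit C × C ⊆ X)
  ¬Independent⇒⊇Circuit k {X} card≡k skew≤1 ¬ind
    with any?ᵉ (λ x → x ∈? X ×-dec ¬? (independent? (X ∖⁅ x ⁆)))
  ¬Independent⇒⊇Circuit zero    card≡0 _ _ | yes (x , x∈X , _) =
    contradiction (trans (card-∖⁅⁆ x∈X) card≡0) λ ()
  ¬Independent⇒⊇Circuit (suc k) card≡ skew≤1 _ | yes (x , x∈X , ¬ind′)
    with ¬Independent⇒⊇Circuit k (suc-injective (trans (card-∖⁅⁆ x∈X) card≡))
                                  (≤-trans (skewCount-mono ∖⁅⁆-⊆) skew≤1) ¬ind′
  ... | C , circ , C⊆X∖x = C , circ , ∖⁅⁆-⊆ ∘ C⊆X∖x
  ¬Independent⇒⊇Circuit k {X} _ skew≤1 ¬ind | no ¬shrinkable =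
    X , (skew≤1 , ¬Independent⇒NotInAnyBasis ¬ind , minimal) , id
    where
    minimal : ∀ D → D ⊆E X → D ≢ X → skewCount D ≤ 1 → ¬ NotInAnyBasis 𝓑 D
    minimal D D⊆X D≢X _ nib with ⊆⊎∃∉ X D
    ... | inj₁ X⊆D = D≢X (⊆-antisym (⊆E⇒⊆ D⊆X) X⊆D)
    ... | inj₂ (x , x∈X , x∉D) = ¬shrinkable (x , x∈X , λ (B , B∈ , X∖x⊆B) →
          NotInAnyBasis⇒¬Independent nib (B , B∈ , X∖x⊆B ∘ ⊆-∖⁅⁆ (⊆E⇒⊆ D⊆X) x∉D))

  Transversal∪⁅⁆-⊇Circuit : {T : SubE n} {e : Elt n} → Transversal T → e ∈ star T →
                              ∃[ C ] (Circuit C × C ⊆ T ∪⁅ e ⁆)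
  Transversal∪⁅⁆-⊇Circuit {T} {e} tr e∈T* =
    ¬Independent⇒⊇Circuit _ refl (skewCount-∪⁅⁆≤1 (proj₂ tr)) (n<card⇒¬Independent n<card)
    where
    e∉T : e ∉ T
    e∉T = subst (_∉ T) (*-involutive e) (Transversal-∈⇒*∉ tr (∈-star⁻ T e∈T*))
    n<card : n < card (T ∪⁅ e ⁆)
    n<card = ≤-reflexive (sym (trans (card-∪⁅⁆ e∉T) (cong suc (proj₁ tr))))

  opaque
    unfolding _∪⁅_⁆

    Max-circuit : (T : SubE n) → Transversal T → (e : Elt n) → e ∈E star T →
                  ∃[ C ] (Circuit C × C ⊆E T ∪E sing e)
    Max-circuit T tr e e∈T* with Transversal∪⁅⁆-⊇Circuit {T} {e} tr (∈E⇒∈ e e∈T*)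
    ... | C , circ , C⊆ = C , circ , ⊆⇒⊆E C⊆

  transversalBasis-avoiding : {B J : SubE n} {x : Elt n} → B ∈F 𝓑 → skewCount B ≡ 1 →
    x ∈ B → x * ∈ B → J ⊆ B → x ∉ J → ∃[ B′ ] (B′ ∈F 𝓑 × skewCount B′ ≡ 0 × J ⊆ B′)
  transversalBasis-avoiding {B} {x = x} B∈ skew≡1 x∈B x*∈B J⊆B x∉J
    with exchange B∈ (∁*-basis B∈) x∈B (λ x∈∁*B → ∈-∁*⁻ B x∈∁*B x*∈B) skew-B∖x skew-∁*B∪x
    where
    skew-B∖x : skewCount (B ∖⁅ x ⁆) ≡ 0
    skew-B∖x = skewCount-∖⁅⁆≡0 skew≡1 x∈B x*∈B
    skew-∁*B∪x : skewCount (∁* B ∪⁅ x ⁆) ≡ 1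
    skew-∁*B∪x = trans (skewCount-∪⁅⁆ (∈⇒*∉∁* x∈B))
                       (trans (card≡n⇒missingCount≡skewCount (basis-card B∈)) skew≡1)
  ... | f , f∈∁*B , _ , B′∈ , _ =
    B ∖⁅ x ⁆ ∪⁅ f ⁆ , B′∈ ,
    trans (skewCount-∪⁅⁆ (∈-∁*⁻ B f∈∁*B ∘ ∖⁅⁆-⊆)) (skewCount-∖⁅⁆≡0 skew≡1 x∈B x*∈B) ,
    ⊆-∪⁅⁆ ∘ ⊆-∖⁅⁆ J⊆B x∉J

  transversalBasis-⊇ : {J : SubE n} → Independent J → skewCount J ≡ 0 →
                       ∃[ B ] (B ∈F 𝓑 × skewCount B ≡ 0 × J ⊆ B)
  transversalBasis-⊇ {J} (B , B∈ , J⊆B) skewJ≡0 with bases-shape B B∈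
  ... | inj₁ (_ , skew≡0) = B , B∈ , skew≡0 , J⊆B
  ... | inj₂ (_ , skew≡1) with skewCount≡1⇒SkewIn {X = B} skew≡1
  ...   | p , p∈B , p*∈B with (p , false) ∈? J
  ...     | no  p∉J = transversalBasis-avoiding B∈ skew≡1 p∈B p*∈B J⊆B p∉J
  ...     | yes p∈J = transversalBasis-avoiding B∈ skew≡1 p*∈B p∈B J⊆B
                        (λ p*∈J → skewCount≡0⇒¬SkewIn skewJ≡0 (p∈J , p*∈J))

  BasisFor : SubE n → Elt n → Set
  BasisFor C e = ∃[ B ] (B ∈F 𝓑 × C ∖⁅ e ⁆ ⊆ B × e ∉ B × skewCount (B ∪⁅ e ⁆) ≡ 1)

  basisFor-skewFree : {C : SubE n} {e : Elt n} → Circuit C → e ∈ C → skewCount (C ∖⁅ e ⁆) ≡ 0 → BasisFor C e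
  basisFor-skewFree circ e∈C skew≡0
    with transversalBasis-⊇ (Circuit-∖⁅⁆-Independent circ e∈C) skew≡0
  ... | B , B∈ , skewB≡0 , C∖e⊆B = B , B∈ , C∖e⊆B , e∉B ,
        skewCount-∪⁅⁆≡1 skewB≡0 (Transversal-∉⇒*∈ (basis-card B∈ , skewB≡0) e∉B)
    where
    e∉B = Circuit-∖⁅⁆⊆basis⇒∉ circ B∈ C∖e⊆B

  -- Exchanging p* from B ⊇ C − e into a basis B₃ ⊇ C − p* must remove e, or else C fits in a basis.
  basisFor-skew : {C : SubE n} {e : Elt n} {p : Fin n} → Circuit C → e ∈ C → SkewIn (C ∖⁅ e ⁆) p →
                  BasisFor C e
  basisFor-skew {C} {e} {p} circ e∈C (p∈C∖e , p*∈C∖e)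
    with basisFor-skewFree circ (∖⁅⁆-⊆ p*∈C∖e) skew-C∖p* | Circuit-∖⁅⁆-Independent circ e∈C
    where
    skew-C∖p* : skewCount (C ∖⁅ p , true ⁆) ≡ 0
    skew-C∖p* = skewCount-∖⁅⁆≡0 (SkewIn⇒skewCount≡1 (proj₁ circ) (∖⁅⁆-⊆ p∈C∖e , ∖⁅⁆-⊆ p*∈C∖e))
                                 (∖⁅⁆-⊆ p*∈C∖e) (∖⁅⁆-⊆ p∈C∖e)
  ... | B₃ , B₃∈ , C∖p*⊆B₃ , p*∉B₃ , skew-B₃∪p* | B , B∈ , C∖e⊆B
    with exchange B∈ B₃∈ (C∖e⊆B p*∈C∖e) p*∉B₃ skew-B∖p* skew-B₃∪p*
    where
    skewB≡1 = SkewIn⇒skewCount≡1 (basis-skewCount≤1 B∈) (C∖e⊆B p∈C∖e , C∖e⊆B p*∈C∖e)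
    skew-B∖p* = skewCount-∖⁅⁆≡0 skewB≡1 (C∖e⊆B p*∈C∖e) (C∖e⊆B p∈C∖e)
  ... | f , _ , f∉B , _ , B′∈ with f ≟ᵉ e
  ...   | no f≢e = ⊥-elim (Circuit⇒¬Independent circ
      (_ , B′∈ , ⊆-∖⁅⁆ (∖⁅⁆⊆⇒⊆∪⁅⁆ C∖p*⊆B₃) (λ f∈C → f∉B (C∖e⊆B (∈-∖⁅⁆⁺ f≢e f∈C)))))
  ...   | yes refl = _ , B′∈ , ∖⁅⁆-mono C⊆B₃∪p* , ∉-∖⁅⁆-self ,
      subst (λ X → skewCount X ≡ 1) (sym (∖⁅⁆-∪⁅⁆ (C⊆B₃∪p* e∈C))) skew-B₃∪p*
    where C⊆B₃∪p* = ∖⁅⁆⊆⇒⊆∪⁅⁆ C∖p*⊆B₃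

  basisFor : {C : SubE n} {e : Elt n} → Circuit C → e ∈ C → BasisFor C e
  basisFor {C} {e} circ e∈C with skewCount (C ∖⁅ e ⁆) ≟ 0
  ... | yes skew≡0 = basisFor-skewFree circ e∈C skew≡0
  ... | no  skew≢0 = basisFor-skew circ e∈C (proj₂ (skewCount≢0⇒SkewIn skew≢0))

  ¬Circuits-∩*≡⁅⁆ : {C₁ C₂ : SubE n} {e : Elt n} → Circuit C₁ → Circuit C₂ → ¬ (C₁ ∩* C₂ ≡⁅ e ⁆)
  ¬Circuits-∩*≡⁅⁆ {C₁} {C₂} {e} circ₁ circ₂ (e∈C₁ , e*∈C₂ , unique)
    with basisFor circ₁ e∈C₁ | basisFor circ₂ e*∈C₂
  ... | B , B∈ , C₁∖e⊆B , e∉B , skew-B∪e | B₂ , B₂∈ , C₂∖e*⊆B₂ , e*∉B₂ , skew-B₂∪e*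
    with exchange (∁*-basis B₂∈) B∈ (∈-∁*⁺ e*∉B₂) e∉B skew-∁*B₂∖e skew-B∪e
    where
    skew-∁*B₂∖e : skewCount (∁* B₂ ∖⁅ e ⁆) ≡ 0
    skew-∁*B₂∖e = subst (λ x → skewCount (∁* B₂ ∖⁅ x ⁆) ≡ 0) (*-involutive e)
                        (skewCount-∁*∖⁅*⁆≡0 (basis-card B₂∈) e*∉B₂ skew-B₂∪e*)
  ... | f , f∈B , _ , Y∈ , Z∈ with f ∈? C₁
  ...   | no  f∉C₁ = Circuit⇒¬Independent circ₁ (_ , Z∈ , ⊆-∖⁅⁆ (∖⁅⁆⊆⇒⊆∪⁅⁆ C₁∖e⊆B) f∉C₁)
  ...   | yes f∈C₁ = Circuit⇒¬Independent circ₂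
      (_ , ∁*-basis Y∈ , subst (C₂ ⊆_) (sym (∁*-∁*∖∪ B₂ e f)) (⊆-∖⁅⁆ (∖⁅⁆⊆⇒⊆∪⁅⁆ C₂∖e*⊆B₂) f*∉C₂))
    where
    f*∉C₂ : f * ∉ C₂
    f*∉C₂ f*∈C₂ = e∉B (subst (_∈ B) (unique f∈C₁ f*∈C₂) f∈B)

module MatroidOfCircuits {n : ℕ} (𝓒 : Family n) (𝓒-skewCount≤1 : ∀ C → C ∈F 𝓒 → skewCount C ≤ 1)
                         (c1 : C1 𝓒) (c2 : C2 𝓒) (orth : Orth 𝓒) (max : Max 𝓒) where

  Dependent : SubE n → Set
  Dependent X = ∃[ C ] (C ∈F 𝓒 × C ⊆ X)

  dependent? : (X : SubE n) → Dec (Dependent X)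
  dependent? X = any?ˢ (λ C → C ∈F? 𝓒 ×-dec C ⊆? X)

  ¬Dependent-⊆ : {X Y : SubE n} → X ⊆ Y → ¬ Dependent Y → ¬ Dependent X
  ¬Dependent-⊆ X⊆Y ¬dep (C , C∈ , C⊆X) = ¬dep (C , C∈ , X⊆Y ∘ C⊆X)

  IsBasis : SubE n → Set
  IsBasis X = card X ≡ n × skewCount X ≤ 1 × ¬ Dependent X

  isBasis? : (X : SubE n) → Dec (IsBasis X)
  isBasis? X = (card X ≟ n) ×-dec (skewCount X ≤? 1) ×-dec ¬? (dependent? X)

  opaque
    𝓑 : Family n
    𝓑 X = ⌊ isBasis? X ⌋

    IsBasis⇒∈𝓑 : {X : SubE n} → IsBasis X → X ∈F 𝓑
    IsBasis⇒∈𝓑 = Equivalence.to Boolₚ.T-≡ ∘ fromWitness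

    ∈𝓑⇒IsBasis : {X : SubE n} → X ∈F 𝓑 → IsBasis X
    ∈𝓑⇒IsBasis = toWitness ∘ Equivalence.from Boolₚ.T-≡

  basis-independent : {B : SubE n} → B ∈F 𝓑 → ¬ Dependent B
  basis-independent = proj₂ ∘ proj₂ ∘ ∈𝓑⇒IsBasis

  ¬∩*≡⁅⁆ : {C D : SubE n} {e : Elt n} → C ∈F 𝓒 → D ∈F 𝓒 → ¬ (C ∩* D ≡⁅ e ⁆)
  ¬∩*≡⁅⁆ C∈ D∈ = orth _ _ C∈ D∈ ∘ ∩*≡⁅⁆⇒card-∩star≡1

  orth-⊆ : {C D X : SubE n} {z : Elt n} → C ∈F 𝓒 → D ∈F 𝓒 →
           C ⊆ X ∪⁅ z ⁆ → D ⊆ ∁* X ∪⁅ z * ⁆ → z * ∈ D → C ⊆ X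
  orth-⊆ C∈ D∈ C⊆ D⊆ z*∈D = ⊆∪⁅⁆⇒⊆ C⊆ λ z∈C → ¬∩*≡⁅⁆ C∈ D∈ (z∈C , z*∈D , ∩*-⊆⁅⁆ C⊆ D⊆)

  opaque
    unfolding _∪⁅_⁆

    Transversal∪⁅⁆-dependent : {T : SubE n} {e : Elt n} → Transversal T → e * ∈ T → Dependent (T ∪⁅ e ⁆)
    Transversal∪⁅⁆-dependent {T} {e} tr e*∈T with max T tr e (∈⇒∈E e (∈-star⁺ e*∈T))
    ... | C , C∈ , C⊆ = C , C∈ , ⊆E⇒⊆ C⊆

  Dependent-∪⁅⁆ : {X : SubE n} {x : Elt n} → ¬ Dependent X → Dependent (X ∪⁅ x ⁆) →
                  ∃[ C ] (C ∈F 𝓒 × C ⊆ X ∪⁅ x ⁆ × x ∈ C)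
  Dependent-∪⁅⁆ {x = x} ¬dep (C , C∈ , C⊆) with x ∈? C
  ... | yes x∈C = C , C∈ , C⊆ , x∈C
  ... | no  x∉C = ⊥-elim (¬dep (C , C∈ , ⊆∪⁅⁆⇒⊆ C⊆ x∉C))

  card≡1+n⇒dependent : {Y : SubE n} → card Y ≡ suc n → skewCount Y ≡ 1 → Dependent Y
  card≡1+n⇒dependent {Y} card≡ skew≡1 with skewCount≡1⇒SkewIn {X = Y} skew≡1
  ... | p , p∈Y , p*∈Y = subst Dependent (∖⁅⁆-∪⁅⁆ p*∈Y)
        (Transversal∪⁅⁆-dependent (card-T , skew-T) (∈-∖⁅⁆⁺ (λ ()) p∈Y))
    where
    card-T : card (Y ∖⁅ p , true ⁆) ≡ n
    card-T = suc-injective (trans (card-∖⁅⁆ p*∈Y) card≡)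
    skew-T : skewCount (Y ∖⁅ p , true ⁆) ≡ 0
    skew-T = skewCount-∖⁅⁆≡0 skew≡1 p*∈Y p∈Y

  -- Max puts some D ∈ 𝒞 in X − p* + w* + p*; Orth against C ∋ w forbids w* ∈ D, so D ⊆ X.
  ∁*-dependent-via : {X C : SubE n} {w : Elt n} → card X ≡ n → skewCount X ≡ 1 → Missing X (proj₁ w) →
                     C ∈F 𝓒 → C ⊆ ∁* X → w ∈ C → Dependent X
  ∁*-dependent-via {X} {C} {w} card≡n skew≡1 w-missing C∈ C⊆∁*X w∈C
    with skewCount≡1⇒SkewIn {X = X} skew≡1
  ... | p , p∈X , p*∈X
    with Transversal∪⁅⁆-dependent {e = p , true} (card-T , skew-T) (⊆-∪⁅⁆ (∈-∖⁅⁆⁺ (λ ()) p∈X))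
    where
    T = X ∖⁅ p , true ⁆ ∪⁅ w * ⁆
    w∉X : w ∉ X
    w∉X = Missing⇒∉ w-missing (proj₂ w)
    w*∉X : w * ∉ X
    w*∉X = Missing⇒∉ w-missing (not (proj₂ w))
    card-T : card T ≡ n
    card-T = trans (card-∪⁅⁆ (w*∉X ∘ ∖⁅⁆-⊆)) (trans (card-∖⁅⁆ p*∈X) card≡n)
    skew-T : skewCount T ≡ 0
    skew-T = trans (skewCount-∪⁅⁆ (subst (_∉ X) (sym (*-involutive w)) w∉X ∘ ∖⁅⁆-⊆))
                   (skewCount-∖⁅⁆≡0 skew≡1 p*∈X p∈X)
  ... | D , D∈ , D⊆ = D , D∈ , orth-⊆ D∈ C∈ D⊆X∪w* (⊆-∪⁅⁆ ∘ C⊆∁*X) (subst (_∈ C) (sym (*-involutive w)) w∈C)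
    where
    D⊆X∪w* : D ⊆ X ∪⁅ w * ⁆
    D⊆X∪w* y∈D with ∈-∪⁅⁆⁻ (D⊆ y∈D)
    ... | inj₁ refl = ⊆-∪⁅⁆ p*∈X
    ... | inj₂ y∈T  = ∪⁅⁆-mono ∖⁅⁆-⊆ y∈T

  ∁*-dependent⇒dependent : {X : SubE n} → card X ≡ n → skewCount X ≡ 1 → Dependent (∁* X) → Dependent X
  ∁*-dependent⇒dependent {X} card≡n skew≡1 (C , C∈ , C⊆∁*X)
    with any?ᵉ (λ w → w ∈? C ×-dec skewIn? (∁* X) (proj₁ w))
  ... | yes (w , w∈C , w-missing) = ∁*-dependent-via card≡n skew≡1 w-missing C∈ C⊆∁*X w∈C
  ... | no ¬∃ = C , C∈ , λ {y} y∈C → decidable-stable (y ∈? X) λ y∉X →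
                  ¬∃ (y , y∈C , ∉⇒Missing y∉X (∈-∁*⁻ X (C⊆∁*X y∈C)))

  ∁*-basis : {X : SubE n} → X ∈F 𝓑 → ∁* X ∈F 𝓑
  ∁*-basis {X} X∈ with ∈𝓑⇒IsBasis X∈
  ... | card≡n , skew≤1 , ¬dep = IsBasis⇒∈𝓑
    (card-∁* card≡n , subst (_≤ 1) (sym (card≡n⇒missingCount≡skewCount card≡n)) skew≤1 , ¬dep∁*)
    where
    ¬dep∁* : ¬ Dependent (∁* X)
    ¬dep∁* with m≤n⇒m<n∨m≡n skew≤1
    ... | inj₁ skew<1 = subst (¬_ ∘ Dependent) (sym (∁*-Transversal (card≡n , n<1⇒n≡0 skew<1))) ¬dep
    ... | inj₂ skew≡1 = ¬dep ∘ ∁*-dependent⇒dependent card≡n skew≡1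

  swap-basis : (T : SubE n) → Transversal T → (p q : Fin n) → p ≢ q →
               (T ∪E skew p) ∖E skew q ∈F 𝓑 → (T ∪E skew q) ∖E skew p ∈F 𝓑
  swap-basis T tr p q p≢q X∈ = subst (_∈F 𝓑) (∁*-swap tr p≢q) (∁*-basis X∈)

  one-side-independent : {J : SubE n} {q : Fin n} → skewCount J ≡ 0 → ¬ Dependent J →
                          ∃[ c ] ¬ Dependent (J ∪⁅ q , c ⁆)
  one-side-independent {J} {q} skew≡0 ¬dep with dependent? (J ∪⁅ q , false ⁆)
  ... | no  ¬dep-f = false , ¬dep-f
  ... | yes (C , C∈ , C⊆) = true , ¬dep-t
    where
    ¬dep-t : ¬ Dependent (J ∪⁅ q , true ⁆)
    ¬dep-t dep-t with Dependent-∪⁅⁆ ¬dep dep-t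
    ... | D , D∈ , D⊆ , q*∈D = ¬dep (C , C∈ , orth-⊆ C∈ D∈ C⊆ (∪⁅⁆-mono (skewFree⇒⊆∁* skew≡0) ∘ D⊆) q*∈D)

  IndependentTransversal⊇ : SubE n → Set
  IndependentTransversal⊇ J = ∃[ T ] (Transversal T × J ⊆ T × ¬ Dependent T)

  extendToTransversalₖ : (k : ℕ) {J : SubE n} → card J + k ≡ n → skewCount J ≡ 0 → ¬ Dependent J →
                         IndependentTransversal⊇ J
  extendToTransversalₖ zero {J} card≡ skew≡0 ¬dep =
    J , (trans (sym (+-identityʳ _)) card≡ , skew≡0) , id , ¬dep
  extendToTransversalₖ (suc k) {J} card≡ skew≡0 ¬dep
    with skewCount≢0⇒SkewIn {X = ∁* J} (1+n≢0 ∘ trans (sym (missingCount-skewFree skew≡0 card≡)))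
  ... | q , q-missing with one-side-independent {q = q} skew≡0 ¬dep
  ...   | c , ¬dep′ with extendToTransversalₖ k card′ skew′ ¬dep′
    where
    card′ : card (J ∪⁅ q , c ⁆) + k ≡ n
    card′ = trans (cong (_+ k) (card-∪⁅⁆ (Missing⇒∉ q-missing c))) (trans (sym (+-suc _ k)) card≡)
    skew′ : skewCount (J ∪⁅ q , c ⁆) ≡ 0
    skew′ = trans (skewCount-∪⁅⁆ (Missing⇒∉ q-missing (not c))) skew≡0
  ...     | T , tr , J′⊆T , ¬depT = T , tr , J′⊆T ∘ ⊆-∪⁅⁆ , ¬depT

  extendToTransversal : {J : SubE n} → skewCount J ≡ 0 → ¬ Dependent J → IndependentTransversal⊇ J
  extendToTransversal {J} skew≡0 = extendToTransversalₖ (missingCount J)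
    (trans (card+missingCount≡n+skewCount J) (trans (cong (n +_) skew≡0) (+-identityʳ n))) skew≡0

  Transversal-basis : {T : SubE n} → Transversal T → ¬ Dependent T → T ∈F 𝓑
  Transversal-basis (card≡n , skew≡0) ¬dep = IsBasis⇒∈𝓑 (card≡n , ≤-trans (≤-reflexive skew≡0) z≤n , ¬dep)

  ¬Dependent∅ : ¬ Dependent ∅
  ¬Dependent∅ (C , C∈ , C⊆∅) = c1 (subst (_∈F 𝓒) (⊆-antisym C⊆∅ (⊥-elim ∘ ∉∅)) C∈)

  some-basis : ∃[ B ] (B ∈F 𝓑)
  some-basis with extendToTransversal (¬SkewIn⇒skewCount≡0 {X = ∅ {n}} λ _ (i∈∅ , _) → ∉∅ i∈∅) ¬Dependent∅
  ... | T , tr , _ , ¬depT = T , Transversal-basis tr ¬depT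

  fundamentalCircuit-∁* : {B : SubE n} {e : Elt n} → B ∈F 𝓑 → e ∈ B → skewCount (B ∖⁅ e ⁆) ≡ 0 →
                         ∃[ D ] (D ∈F 𝓒 × D ⊆ ∁* B ∪⁅ e * ⁆ × e * ∈ D)
  fundamentalCircuit-∁* {B} {e} B∈ e∈B skew≡0 =
    Dependent-∪⁅⁆ (basis-independent (∁*-basis B∈)) (card≡1+n⇒dependent card′ skew′)
    where
    card≡n = proj₁ (∈𝓑⇒IsBasis B∈)
    card′ : card (∁* B ∪⁅ e * ⁆) ≡ suc n
    card′ = trans (card-∪⁅⁆ (∈⇒*∉∁* e∈B)) (cong suc (card-∁* card≡n))
    skew′ : skewCount (∁* B ∪⁅ e * ⁆) ≡ 1
    skew′ = trans (cong skewCount (sym (∁*-∖⁅⁆ B e)))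
                  (missingCount-skewFree skew≡0 (trans (+-comm _ 1) (trans (card-∖⁅⁆ e∈B) card≡n)))

  basis-∖∪ : {B D : SubE n} {e f : Elt n} → B ∈F 𝓑 → e ∈ B → skewCount (B ∖⁅ e ⁆) ≡ 0 →
             D ∈F 𝓒 → D ⊆ ∁* B ∪⁅ e * ⁆ → f * ∈ D → f ∉ B → B ∖⁅ e ⁆ ∪⁅ f ⁆ ∈F 𝓑
  basis-∖∪ {B} {D} {e} {f} B∈ e∈B skew≡0 D∈ D⊆ f*∈D f∉B = IsBasis⇒∈𝓑 (card′ , skewCount-∪⁅⁆≤1 skew≡0 , ¬dep)
    where
    card′ : card (B ∖⁅ e ⁆ ∪⁅ f ⁆) ≡ n
    card′ = trans (card-∪⁅⁆ (f∉B ∘ ∖⁅⁆-⊆)) (trans (card-∖⁅⁆ e∈B) (proj₁ (∈𝓑⇒IsBasis B∈)))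
    D⊆′ : D ⊆ ∁* (B ∖⁅ e ⁆) ∪⁅ f * ⁆
    D⊆′ = ⊆-∪⁅⁆ ∘ subst (D ⊆_) (sym (∁*-∖⁅⁆ B e)) D⊆
    ¬dep : ¬ Dependent (B ∖⁅ e ⁆ ∪⁅ f ⁆)
    ¬dep (D′ , D′∈ , D′⊆) = basis-independent B∈ (D′ , D′∈ , ∖⁅⁆-⊆ ∘ orth-⊆ D′∈ D∈ D′⊆ D⊆′ f*∈D)

  -- The image of basis-∖∪ under X ↦ ∁* X.
  basis-∪∖ : {B C : SubE n} {e f : Elt n} → B ∈F 𝓑 → e ∉ B → skewCount (B ∪⁅ e ⁆) ≡ 1 →
             C ∈F 𝓒 → C ⊆ B ∪⁅ e ⁆ → f ∈ C → f ∈ B → B ∪⁅ e ⁆ ∖⁅ f ⁆ ∈F 𝓑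
  basis-∪∖ {B} {C} {e} {f} B∈ e∉B skew≡1 C∈ C⊆ f∈C f∈B = subst (_∈F 𝓑) ∁*W≡ (∁*-basis W∈)
    where
    W∈ : ∁* B ∖⁅ e * ⁆ ∪⁅ f * ⁆ ∈F 𝓑
    W∈ = basis-∖∪ (∁*-basis B∈) (∈-∁*⁺ (subst (_∉ B) (sym (*-involutive e)) e∉B))
           (skewCount-∁*∖⁅*⁆≡0 (proj₁ (∈𝓑⇒IsBasis B∈)) e∉B skew≡1) C∈
           (subst (C ⊆_) (sym (cong₂ _∪⁅_⁆ (∁*-involutive B) (*-involutive e))) C⊆)
           (subst (_∈ C) (sym (*-involutive f)) f∈C) (∈⇒*∉∁* f∈B)
    ∁*W≡ : ∁* (∁* B ∖⁅ e * ⁆ ∪⁅ f * ⁆) ≡ B ∪⁅ e ⁆ ∖⁅ f ⁆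
    ∁*W≡ = trans (∁*-∁*∖∪ B (e *) (f *))
                 (cong₂ (λ x y → B ∪⁅ x ⁆ ∖⁅ y ⁆) (*-involutive e) (*-involutive f))

  exchange : {B B′ : SubE n} {e : Elt n} → B ∈F 𝓑 → B′ ∈F 𝓑 → e ∈ B → e ∉ B′ →
             skewCount (B ∖⁅ e ⁆) ≡ 0 → skewCount (B′ ∪⁅ e ⁆) ≡ 1 →
             ∃[ f ] (f ∈ B′ × f ∉ B × B ∖⁅ e ⁆ ∪⁅ f ⁆ ∈F 𝓑 × B′ ∪⁅ e ⁆ ∖⁅ f ⁆ ∈F 𝓑)
  exchange {B} {B′} {e} B∈ B′∈ e∈B e∉B′ skew≡0 skew≡1 =
    from-circuits (fundamentalCircuit-∁* B∈ e∈B skew≡0)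
                  (Dependent-∪⁅⁆ (basis-independent B′∈) (card≡1+n⇒dependent card′ skew≡1))
    where
    card′ : card (B′ ∪⁅ e ⁆) ≡ suc n
    card′ = trans (card-∪⁅⁆ e∉B′) (cong suc (proj₁ (∈𝓑⇒IsBasis B′∈)))
    from-circuits : ∃[ D ] (D ∈F 𝓒 × D ⊆ ∁* B ∪⁅ e * ⁆ × e * ∈ D) →
                    ∃[ C ] (C ∈F 𝓒 × C ⊆ B′ ∪⁅ e ⁆ × e ∈ C) →
                    ∃[ f ] (f ∈ B′ × f ∉ B × B ∖⁅ e ⁆ ∪⁅ f ⁆ ∈F 𝓑 × B′ ∪⁅ e ⁆ ∖⁅ f ⁆ ∈F 𝓑)
    from-circuits (D , D∈ , D⊆ , e*∈D) (C , C∈ , C⊆ , e∈C) with ¬∩*≡⁅⁆⇒∃ e∈C e*∈D (¬∩*≡⁅⁆ C∈ D∈)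
    ... | f , f∈C , f*∈D , f≢e =
      f , f∈B′ , f∉B , basis-∖∪ B∈ e∈B skew≡0 D∈ D⊆ f*∈D f∉B , basis-∪∖ B′∈ e∉B′ skew≡1 C∈ C⊆ f∈C f∈B′
      where
      f∈B′ : f ∈ B′
      f∈B′ = ∈-∪⁅⁆-≢ (C⊆ f∈C) f≢e
      f∉B : f ∉ B
      f∉B f∈B = ∈-∁*⁻ B (∈-∪⁅⁆-≢ (D⊆ f*∈D) (f≢e ∘ *-injective)) (subst (_∈ B) (sym (*-involutive f)) f∈B)

  basis-∪⁅⁆-⊇ : {B X : SubE n} {x : Elt n} → B ∈F 𝓑 → x ∉ B → skewCount (B ∪⁅ x ⁆) ≡ 1 →
                X ⊆ B ∪⁅ x ⁆ → x ∈ X → ¬ Dependent X → ∃[ B′ ] (B′ ∈F 𝓑 × X ⊆ B′)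
  basis-∪⁅⁆-⊇ {B} {X} {x} B∈ x∉B skew≡1 X⊆ x∈X ¬depX
    with Dependent-∪⁅⁆ (basis-independent B∈)
           (card≡1+n⇒dependent (trans (card-∪⁅⁆ x∉B) (cong suc (proj₁ (∈𝓑⇒IsBasis B∈)))) skew≡1)
  ... | C , C∈ , C⊆ , x∈C with ⊆⊎∃∉ C X
  ...   | inj₁ C⊆X = ⊥-elim (¬depX (C , C∈ , C⊆X))
  ...   | inj₂ (f , f∈C , f∉X) = _ , basis-∪∖ B∈ x∉B skew≡1 C∈ C⊆ f∈C f∈B , ⊆-∖⁅⁆ X⊆ f∉X
    where
    f∈B : f ∈ B
    f∈B = ∈-∪⁅⁆-≢ (C⊆ f∈C) λ { refl → f∉X x∈X }

  independent⇒⊆basis : {X : SubE n} → skewCount X ≤ 1 → ¬ Dependent X → ∃[ B ] (B ∈F 𝓑 × X ⊆ B)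
  independent⇒⊆basis {X} skew≤1 ¬dep with m≤n⇒m<n∨m≡n skew≤1
  ... | inj₁ skew<1 with extendToTransversal (n<1⇒n≡0 skew<1) ¬dep
  ...   | T , tr , X⊆T , ¬depT = T , Transversal-basis tr ¬depT , X⊆T
  independent⇒⊆basis {X} skew≤1 ¬dep | inj₂ skew≡1
    with skewCount≡1⇒SkewIn {X = X} skew≡1
  ... | p , p∈X , p*∈X
    with extendToTransversal (skewCount-∖⁅⁆≡0 skew≡1 p*∈X p∈X) (¬Dependent-⊆ ∖⁅⁆-⊆ ¬dep)
  ... | T , tr , X∖p*⊆T , ¬depT =
    basis-∪⁅⁆-⊇ (Transversal-basis tr ¬depT) p*∉T (skewCount-∪⁅⁆≡1 (proj₂ tr) p∈T)
                (∖⁅⁆⊆⇒⊆∪⁅⁆ X∖p*⊆T) p*∈X ¬dep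
    where
    p∈T : (p , false) ∈ T
    p∈T = X∖p*⊆T (∈-∖⁅⁆⁺ (λ ()) p∈X)
    p*∉T : (p , true) ∉ T
    p*∉T = Transversal-∈⇒*∉ tr p∈T

  opaque
    unfolding _∪⁅_⁆ _∖⁅_⁆

    Exch-bases : ∀ B B′ → B ∈F 𝓑 → B′ ∈F 𝓑 → (e : Elt n) → e ∈E B → ¬ (e ∈E B′) →
            skewCount (B ∖E sing e) ≡ 0 → skewCount (B′ ∪E sing e) ≡ 1 →
            ∃[ f ] (f ∈E B′ × ¬ (f ∈E B) × ((B ∖E sing e) ∪E sing f) ∈F 𝓑 × ((B′ ∪E sing e) ∖E sing f) ∈F 𝓑)
    Exch-bases B B′ B∈ B′∈ e e∈B e∉B′ skew≡0 skew≡1 =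
      let (f , f∈B′ , f∉B , B₁∈ , B₂∈) =
            exchange {B} {B′} {e} B∈ B′∈ (∈E⇒∈ e e∈B) (e∉B′ ∘ ∈⇒∈E e) skew≡0 skew≡1
      in f , ∈⇒∈E f f∈B′ , f∉B ∘ ∈E⇒∈ f , B₁∈ , B₂∈

  isAntisymmetricMatroid : IsAntisymmetricMatroid 𝓑
  isAntisymmetricMatroid = record
    { bases-shape = shape
    ; B1          = some-basis
    ; B2          = λ T tr p q p≢q → swap-basis T tr p q p≢q , swap-basis T tr q p (p≢q ∘ sym)
    ; Exch        = Exch-bases
    }
    where
    shape : ∀ B → B ∈F 𝓑 → Transversal B ⊎ AlmostTransversal B
    shape B B∈ with ∈𝓑⇒IsBasis B∈
    ... | card≡n , skew≤1 , _ with m≤n⇒m<n∨m≡n skew≤1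
    ...   | inj₁ skew<1 = inj₁ (card≡n , n<1⇒n≡0 skew<1)
    ...   | inj₂ skew≡1 = inj₂ (card≡n , skew≡1)

  Dependent⇒NotInAnyBasis : {X : SubE n} → Dependent X → NotInAnyBasis 𝓑 X
  Dependent⇒NotInAnyBasis (C , C∈ , C⊆X) B B∈ X⊆B = basis-independent B∈ (C , C∈ , ⊆E⇒⊆ X⊆B ∘ C⊆X)

  NotInAnyBasis⇒Dependent : {X : SubE n} → skewCount X ≤ 1 → NotInAnyBasis 𝓑 X → Dependent X
  NotInAnyBasis⇒Dependent {X} skew≤1 nib = decidable-stable (dependent? X) λ ¬dep →
    let (B , B∈ , X⊆B) = independent⇒⊆basis skew≤1 ¬dep in nib B B∈ (⊆⇒⊆E X⊆B)

  ∈𝓒⇒Circuit : {C : SubE n} → C ∈F 𝓒 → IsCircuit 𝓑 C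
  ∈𝓒⇒Circuit {C} C∈ = 𝓒-skewCount≤1 C C∈ , Dependent⇒NotInAnyBasis (C , C∈ , id) , minimal
    where
    minimal : ∀ D → D ⊆E C → D ≢ C → skewCount D ≤ 1 → ¬ NotInAnyBasis 𝓑 D
    minimal D D⊆C D≢C skew≤1 nib with NotInAnyBasis⇒Dependent skew≤1 nib
    ... | C′ , C′∈ , C′⊆D with c2 C′ C C′∈ C∈ (⊆⇒⊆E (⊆E⇒⊆ D⊆C ∘ C′⊆D))
    ...   | refl = D≢C (⊆-antisym (⊆E⇒⊆ D⊆C) C′⊆D)

  Circuit⇒∈𝓒 : {X : SubE n} → IsCircuit 𝓑 X → X ∈F 𝓒
  Circuit⇒∈𝓒 {X} (skew≤1 , nib , minimal) with NotInAnyBasis⇒Dependent skew≤1 nib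
  ... | C , C∈ , C⊆X with C ≟ˢ X
  ...   | yes refl = C∈
  ...   | no  C≢X = ⊥-elim (minimal C (⊆⇒⊆E C⊆X) C≢X (𝓒-skewCount≤1 C C∈)
                                    (Dependent⇒NotInAnyBasis (C , C∈ , id)))

theorem3p3 : (n : ℕ) (𝓒 : Family n) →
    (∀ C → C ∈F 𝓒 → skewCount C ≤ 1) →
    IsCircuitSetOfAntisymmetricMatroid 𝓒 ⇔ (C1 𝓒 × C2 𝓒 × Orth 𝓒 × Max 𝓒)
theorem3p3 n 𝓒 𝓒-skewCount≤1 = mk⇔ circuitAxioms matroid
  where
  circuitAxioms : IsCircuitSetOfAntisymmetricMatroid 𝓒 → C1 𝓒 × C2 𝓒 × Orth 𝓒 × Max 𝓒
  circuitAxioms (𝓑 , M , circuits) =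
      ¬Circuit∅ ∘ circuit
    , (λ _ _ C₁∈ C₂∈ → Circuit-⊆⇒≡ (circuit C₁∈) (circuit C₂∈))
    , (λ _ _ C₁∈ C₂∈ → ¬Circuits-∩*≡⁅⁆ (circuit C₁∈) (circuit C₂∈) ∘ proj₂ ∘ card-∩star≡1⇒∩*≡⁅⁆)
    , λ T tr e e∈T* → let (C , circ , C⊆) = Max-circuit T tr e e∈T* in C , proj₂ (circuits C) circ , C⊆
    where
    open CircuitsOfMatroid M
    circuit : ∀ {C} → C ∈F 𝓒 → Circuit C
    circuit = proj₁ (circuits _)
  matroid : C1 𝓒 × C2 𝓒 × Orth 𝓒 × Max 𝓒 → IsCircuitSetOfAntisymmetricMatroid 𝓒
  matroid (c1 , c2 , orth , max) = 𝓑 , isAntisymmetricMatroid , λ _ → ∈𝓒⇒Circuit , Circuit⇒∈𝓒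
    where open MatroidOfCircuits 𝓒 𝓒-skewCount≤1 c1 c2 orth max
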